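{- Let $G$ be a minimal matching covered bipartite graph with a bipartite ear decomposition $C+P_{1}+\cdots+P_{k}+P_{k+1}+\cdots+P_{k+r}$, where each $P_{k+i}$ ($i=1,\dots,r$) has at least one end on $P_{k}$. Let $P_{k+r+1}$ be a nontrivial ear of $G$ whose two ends are two nonadjacent vertices of $P_k$ lying in different parts of $G$, and suppose $P_{k+r+1}$ is compatible with $P_{k+i}$ for every $1\leq i\leq r$. Then $G'=G+P_{k+r+1}$ is a minimal matching covered bipartite graph.
   Context: All graphs are finite and simple. A connected nontrivial graph is matching covered if every edge lies in some perfect matching; a matching covered graph $G$ is minimal if $G-e$ is not matching covered for every edge $e$. An ear of a graph $H$ is a path of odd length whose two ends lie in $H$ but whose internal vertices (and edges) do not; it is trivial if it has exactly one edge and nontrivial otherwise. For a bipartite graph $G$, a bipartite ear decomposition is a sequence $G_0=K_2, G_1,\dots,G_k=G$ of subgraphs with $G_{i+1}=G_i+P_{i+1}$ where $P_{i+1}$ is an ear of $G_i$ joining vertices in different parts of $G_i$; then $G_1$ is an even cycle, and the decomposition is written $C+P_1+\cdots+P_k$ with $C=G_1$ and the later ears relabeled. $H+P$ denotes the union of $H$ and the ear $P$. Two ears (or families of ears sharing the same ends) each having at least one end on the ear $P_k$ are called compatible if their ends lying on $P_k$ appear in order along $P_k$, i.e., traversing $P_k$ one meets all the ends on $P_k$ of one of them before all the ends on $P_k$ of the other (their spans on $P_k$ neither cross nor nest). -}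

module Defs where

open import Data.Nat using (ℕ; zero; suc; _+_; _*_; _<_)
open import Data.Fin using (Fin)
open import Data.Bool using (Bool; true; false)
open import Data.List using (List; []; _∷_; _∷ʳ_; length)
open import Data.List.Membership.Propositional using (_∈_)
open import Data.List.Relation.Unary.All using (All)
open import Data.List.Relation.Unary.Unique.Propositional using (Unique)
open import Data.Product using (Σ; ∃; _×_; _,_)
open import Data.Sum using (_⊎_)
open import Relation.Nullary using (¬_)
open import Relation.Binary.PropositionalEquality using (_≡_; _≢_)
open import Function.Bundles using (_⇔_)

record Graph (N : ℕ) : Set where
  field
    V     : Fin N → Bool
    E     : Fin N → Fin N → Bool
    E-sym : ∀ u v → E u v ≡ E v u
    E-irr : ∀ v → E v v ≡ false
    E-V   : ∀ u v → E u v ≡ true → V u ≡ true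
open Graph public

module _ {N : ℕ} where

  SameGraph : Graph N → Graph N → Set
  SameGraph G H = (∀ v → (V G v ≡ true) ⇔ (V H v ≡ true))
                × (∀ u v → (E G u v ≡ true) ⇔ (E H u v ≡ true))

  data Reach (G : Graph N) : Fin N → Fin N → Set where
    here : ∀ {v} → Reach G v v
    step : ∀ {u v w} → E G u v ≡ true → Reach G v w → Reach G u w

  Connected : Graph N → Set
  Connected G = ∀ u v → V G u ≡ true → V G v ≡ true → Reach G u v

  Nontrivial : Graph N → Set
  Nontrivial G = Σ (Fin N) λ u → Σ (Fin N) λ v →
                 u ≢ v × V G u ≡ true × V G v ≡ true

  IsPerfectMatching : Graph N → (Fin N → Fin N → Bool) → Set
  IsPerfectMatching G M =
      (∀ u v → M u v ≡ true → E G u v ≡ true)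
    × (∀ u v → M u v ≡ M v u)
    × (∀ v → V G v ≡ true →
         Σ (Fin N) λ w → M v w ≡ true × (∀ w′ → M v w′ ≡ true → w′ ≡ w))

  MatchingCovered : Graph N → Set
  MatchingCovered G =
      Connected G × Nontrivial G
    × (∀ u v → E G u v ≡ true →
         Σ (Fin N → Fin N → Bool) λ M → IsPerfectMatching G M × M u v ≡ true)

  DeleteEdge : Graph N → Fin N → Fin N → Graph N → Set
  DeleteEdge G u v H =
      (∀ x → (V H x ≡ true) ⇔ (V G x ≡ true))
    × (∀ x y → (E H x y ≡ true) ⇔
         (E G x y ≡ true × ¬ ((x ≡ u × y ≡ v) ⊎ (x ≡ v × y ≡ u))))

  MinimalMatchingCovered : Graph N → Set
  MinimalMatchingCovered G =
      MatchingCovered G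
    × (∀ u v → E G u v ≡ true → ∀ H → DeleteEdge G u v H → ¬ MatchingCovered H)

  ProperColouring : Graph N → (Fin N → Bool) → Set
  ProperColouring G c = ∀ u v → E G u v ≡ true → c u ≢ c v

  Bipartite : Graph N → Set
  Bipartite G = Σ (Fin N → Bool) λ c → ProperColouring G c

  DifferentParts : Graph N → Fin N → Fin N → Set
  DifferentParts G u v = ∀ c → ProperColouring G c → c u ≢ c v

  IsK2 : Graph N → Set
  IsK2 G = Σ (Fin N) λ a → Σ (Fin N) λ b → a ≢ b
         × (∀ v → (V G v ≡ true) ⇔ (v ≡ a ⊎ v ≡ b))
         × (∀ u v → (E G u v ≡ true) ⇔ ((u ≡ a × v ≡ b) ⊎ (u ≡ b × v ≡ a)))

record Ear (N : ℕ) : Set where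
  field
    start : Fin N
    inner : List (Fin N)
    end   : Fin N
open Ear public

module _ {N : ℕ} where

  verts : Ear N → List (Fin N)
  verts P = start P ∷ (inner P ∷ʳ end P)

  data Consec {A : Set} : List A → A → A → Set where
    here  : ∀ {x y xs} → Consec (x ∷ y ∷ xs) x y
    there : ∀ {z xs x y} → Consec xs x y → Consec (z ∷ xs) x y

  EarEdge : Ear N → Fin N → Fin N → Set
  EarEdge P u v = Consec (verts P) u v ⊎ Consec (verts P) v u

  IsEar : Graph N → Ear N → Set
  IsEar H P =
      V H (start P) ≡ true × V H (end P) ≡ true
    × All (λ x → V H x ≡ false) (inner P)
    × Unique (verts P)
    × (Σ ℕ λ t → length (inner P) ≡ t + t)          -- odd length
    × (∀ u v → EarEdge P u v → E H u v ≡ false)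

  NontrivialEar : Ear N → Set
  NontrivialEar P = inner P ≢ []

  IsBipartiteEar : Graph N → Ear N → Set
  IsBipartiteEar H P = IsEar H P × DifferentParts H (start P) (end P)

  IsEarSum : Graph N → Ear N → Graph N → Set
  IsEarSum H P H′ =
      (∀ v → (V H′ v ≡ true) ⇔ (V H v ≡ true ⊎ v ∈ verts P))
    × (∀ u v → (E H′ u v ≡ true) ⇔ (E H u v ≡ true ⊎ EarEdge P u v))

  -- Bipartite ear decomposition  G₀ = K₂, G₁, …, G_len = G with
  -- G_{i+1} = G_i + ear (suc i).  Thus C = G₁ = K₂ + ear 1, and in the
  -- paper's relabelling P_j = ear (suc j).
  record BipEarDecomp (G : Graph N) : Set where
    field
      len   : ℕ
      stage : ℕ → Graph N
      ear   : ℕ → Ear N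
      base  : IsK2 (stage 0)
      steps : ∀ i → i < len →
                IsBipartiteEar (stage i) (ear (suc i))
              × IsEarSum (stage i) (ear (suc i)) (stage (suc i))
      final : SameGraph (stage len) G
  open BipEarDecomp public

  data At {A : Set} : List A → ℕ → A → Set where
    here  : ∀ {x xs} → At (x ∷ xs) 0 x
    there : ∀ {y xs i x} → At xs i x → At (y ∷ xs) (suc i) x

  EndPos : List (Fin N) → Ear N → ℕ → Set
  EndPos L Q i = At L i (start Q) ⊎ At L i (end Q)

  Compatible : List (Fin N) → Ear N → Ear N → Set
  Compatible L Q R =
      (∀ i j → EndPos L Q i → EndPos L R j → i < j)
    ⊎ (∀ i j → EndPos L Q i → EndPos L R j → j < i)

{-# OPTIONS --safe #-}
module Submission where

-- Let u, v be the ends of Q and S the segment of P_k between them.  An inner vertex of P_k gains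
-- neighbours off P_k only as an end of a later ear, and compatibility keeps those ends off the inside
-- of S, so the inner vertices of S have degree two in G.  A proper colouring and u ≁ v make S odd of
-- length at least three, like Q; thus G′ is G with a second such path Q parallel to S.
--
-- An edge of G′ lies in a perfect matching obtained either by extending one of G by the inner
-- matching of Q, or by taking one of G through the first edge of S, which forces S to be matched
-- outer, and rerouting it so that Q is matched outer and S inner.  Deleting an edge of S or Q leaves
-- an inner vertex of degree one whose neighbour has another neighbour, which no matching covered
-- graph allows.  Deleting any other edge xy: a perfect matching of G′ − xy either avoids the first
-- edge of Q, and then restricts to G − xy, or uses it, and then matches Q outer and S inner and can
-- be rerouted onto S.  So G′ − xy matching covered would make G − xy matching covered, against the
-- minimality of G.

open import Defs
open import Data.Nat using (ℕ; zero; suc; _+_; _∸_; _≤_; _<_; z≤n; s≤s; _≤?_)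
import Data.Nat as ℕ
open import Data.Nat.Properties
  using ( suc-injective; +-suc; +-comm; +-identityʳ; +-cancelˡ-≡; +-mono-≤; +-monoʳ-≤; +-monoʳ-<
        ; ≤-refl; ≤-trans; ≤-pred; <⇒≤; ≤∧≢⇒<; n≤1+n; m≤m+n; m≤n⇒m<n∨m≡n; <-irrefl; <-asym; ≤-total
        ; m∸n≤m; ∸-cancelˡ-≡; ∸-monoʳ-<; +-∸-assoc; m+[n∸m]≡n; m<n⇒0<n∸m; m≤n+o⇒m∸n≤o; n∸n≡0; anyUpTo? )
open import Data.Fin using (Fin)
open import Data.Fin.Properties using (_≟_; any?)
open import Data.Bool using (Bool; true; false; not; _∧_)
import Data.Bool.Properties as Bool
open import Data.Bool.Properties using (not-¬; ¬-not; not-involutive)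
open import Data.List using (List; []; _∷_; _∷ʳ_; length)
open import Data.List.Properties using (length-++)
open import Data.List.Membership.Propositional using (_∈_)
open import Data.List.Membership.Propositional.Properties using (∈-++⁻; ∈-++⁺ˡ)
open import Data.List.Relation.Unary.Any using (here; there)
import Data.List.Relation.Unary.All as All
open import Data.List.Relation.Unary.AllPairs using (_∷_)
open import Data.List.Relation.Unary.Unique.Propositional using (Unique)
open import Data.Product using (Σ; ∃; _×_; _,_; proj₁; proj₂)
open import Data.Sum using (_⊎_; inj₁; inj₂; [_,_]′)
import Data.Sum as Sum
open import Data.Empty using (⊥; ⊥-elim)
open import Function.Base using (id; _∘_; _∘′_)
open import Function.Bundles using (_⇔_; Equivalence; mk⇔)
open import Level using (0ℓ)
open import Relation.Nullary using (¬_; Dec; yes; no; does)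
open import Relation.Nullary.Decidable using (dec-true; dec-false; does-⇔; decidable-stable; map′; _×-dec_; _⊎-dec_; ¬?)
open import Relation.Unary using (Pred; Decidable; _∪_; _∖_; _≐_)
open import Relation.Binary.PropositionalEquality using (_≡_; _≢_; refl; sym; trans; cong; cong₂; subst; subst₂)

open Equivalence using (to; from)

true≢false : true ≢ false
true≢false ()

∧-trueˡ : ∀ {a b} → a ∧ b ≡ true → a ≡ true
∧-trueˡ {true} _ = refl

∧-trueʳ : ∀ {a b} → a ∧ b ≡ true → b ≡ true
∧-trueʳ {true} e = e

SameEdge : {A : Set} → A → A → A → A → Set
SameEdge u v x y = (x ≡ u × y ≡ v) ⊎ (x ≡ v × y ≡ u)

module _ {A : Set} {u v : A} where

  sameEdge-swap : ∀ {x y} → SameEdge u v x y → SameEdge u v y x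
  sameEdge-swap (inj₁ (x≡u , y≡v)) = inj₂ (y≡v , x≡u)
  sameEdge-swap (inj₂ (x≡v , y≡u)) = inj₁ (y≡u , x≡v)

  sameEdge-sym : ∀ {x y} → SameEdge u v x y → SameEdge x y u v
  sameEdge-sym (inj₁ (refl , refl)) = inj₁ (refl , refl)
  sameEdge-sym (inj₂ (refl , refl)) = inj₂ (refl , refl)

  sameEdge-trans : ∀ {x y a b} → SameEdge u v x y → SameEdge x y a b → SameEdge u v a b
  sameEdge-trans (inj₁ (refl , refl)) s = s
  sameEdge-trans (inj₂ (refl , refl)) s = Sum.swap s

  sameEdge-map : ∀ {B : Set} (f : A → B) {x y} → SameEdge u v x y → SameEdge (f u) (f v) (f x) (f y)
  sameEdge-map f (inj₁ (refl , refl)) = inj₁ (refl , refl)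
  sameEdge-map f (inj₂ (refl , refl)) = inj₂ (refl , refl)

module _ {N : ℕ} where

  E-Vʳ : ∀ (K : Graph N) u v → E K u v ≡ true → V K v ≡ true
  E-Vʳ K u v e = E-V K v u (trans (E-sym K v u) e)

  edge-sym : ∀ (K : Graph N) {u v} → E K u v ≡ true → E K v u ≡ true
  edge-sym K {u} {v} e = trans (E-sym K v u) e

  reach-trans : ∀ {K : Graph N} {x y z} → Reach K x y → Reach K y z → Reach K x z
  reach-trans here r = r
  reach-trans (step e r) r′ = step e (reach-trans r r′)

  reach-sym : ∀ {K : Graph N} {x y} → Reach K x y → Reach K y x
  reach-sym here = here
  reach-sym {K} (step e r) = reach-trans (reach-sym r) (step (edge-sym K e) here)

  reach-map : ∀ {K K′ : Graph N} (φ : Fin N → Fin N)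
            → (∀ {x y} → E K x y ≡ true → Reach K′ (φ x) (φ y))
            → ∀ {x y} → Reach K x y → Reach K′ (φ x) (φ y)
  reach-map φ f here = here
  reach-map φ f (step e r) = reach-trans (f e) (reach-map φ f r)

  Vertex : Graph N → Pred (Fin N) 0ℓ
  Vertex K w = V K w ≡ true

  -- A perfect matching of K[Y], given by the involution π sending each vertex to its partner.
  record PairingOn (K : Graph N) (Y : Pred (Fin N) 0ℓ) (π : Fin N → Fin N) : Set where
    field
      adjacent   : ∀ {w} → Y w → E K w (π w) ≡ true
      closed     : ∀ {w} → Y w → Y (π w)
      involutive : ∀ {w} → Y w → π (π w) ≡ w
  open PairingOn public

  PerfectPairing : Graph N → (Fin N → Fin N) → Set
  PerfectPairing K = PairingOn K (Vertex K)

  PairingThrough : Graph N → Fin N → Fin N → Set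
  PairingThrough K x y = Σ (Fin N → Fin N) λ π → PerfectPairing K π × π x ≡ y

  EdgeCovered : Graph N → Set
  EdgeCovered K = ∀ {x y} → E K x y ≡ true → PairingThrough K x y

  module _ {K : Graph N} {Y : Pred (Fin N) 0ℓ} {π : Fin N → Fin N} where

    mate-swap : PairingOn K Y π → ∀ {x y} → Y x → π x ≡ y → π y ≡ x
    mate-swap P yx refl = involutive P yx

    pairingOn-≗ : ∀ {σ} → (∀ {w} → Y w → π w ≡ σ w) → PairingOn K Y π → PairingOn K Y σ
    pairingOn-≗ {σ} π≗σ P = record
      { adjacent   = λ {w} y → subst (λ t → E K w t ≡ true) (π≗σ y) (adjacent P y)
      ; closed     = λ y → subst Y (π≗σ y) (closed P y)
      ; involutive = λ {w} y → trans (cong σ (sym (π≗σ y))) (trans (sym (π≗σ (closed P y))) (involutive P y))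
      }

    pairingOn-≐ : ∀ {Z} → Y ≐ Z → PairingOn K Y π → PairingOn K Z π
    pairingOn-≐ (Y⊆Z , Z⊆Y) P = record
      { adjacent   = λ z → adjacent P (Z⊆Y z)
      ; closed     = λ z → Y⊆Z (closed P (Z⊆Y z))
      ; involutive = λ z → involutive P (Z⊆Y z)
      }

    pairingOn-∖ : ∀ {Z : Pred (Fin N) 0ℓ} → (∀ {w} → Y w → Z w → Z (π w))
                → PairingOn K Y π → PairingOn K (Y ∖ Z) π
    pairingOn-∖ {Z} π[Z]⊆Z P = record
      { adjacent   = λ (y , _) → adjacent P y
      ; closed     = λ (y , ¬z) → closed P y
                                , λ z → ¬z (subst Z (involutive P y) (π[Z]⊆Z (closed P y) z))
      ; involutive = λ (y , _) → involutive P y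
      }

    pairingOn-transfer : ∀ {K′} → (∀ {w} → Y w → E K w (π w) ≡ true → E K′ w (π w) ≡ true)
                       → PairingOn K Y π → PairingOn K′ Y π
    pairingOn-transfer K⇒K′ P = record
      { adjacent = λ y → K⇒K′ y (adjacent P y) ; closed = closed P ; involutive = involutive P }

  pairingThrough-sameEdge : ∀ {K π u v x y} → PerfectPairing K π → V K u ≡ true → π u ≡ v
                          → SameEdge u v x y → PairingThrough K x y
  pairingThrough-sameEdge {π = π} P _  πu≡v (inj₁ (refl , refl)) = π , P , πu≡v
  pairingThrough-sameEdge {π = π} P vu πu≡v (inj₂ (refl , refl)) = π , P , mate-swap P vu πu≡v

  pairingOn-∪ : ∀ {K Y Z π} → PairingOn K Y π → PairingOn K Z π → PairingOn K (Y ∪ Z) π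
  pairingOn-∪ P R = record
    { adjacent   = λ { (inj₁ y) → adjacent P y ; (inj₂ z) → adjacent R z }
    ; closed     = λ { (inj₁ y) → inj₁ (closed P y) ; (inj₂ z) → inj₂ (closed R z) }
    ; involutive = λ { (inj₁ y) → involutive P y ; (inj₂ z) → involutive R z }
    }

  patch : ∀ {Y : Pred (Fin N) 0ℓ} → Decidable Y → (Fin N → Fin N) → (Fin N → Fin N) → Fin N → Fin N
  patch Y? π σ w with Y? w
  ... | yes _ = π w
  ... | no _  = σ w

  module _ {Y : Pred (Fin N) 0ℓ} (Y? : Decidable Y) (π σ : Fin N → Fin N) where

    patch-in : ∀ {w} → Y w → patch Y? π σ w ≡ π w
    patch-in {w} y with Y? w
    ... | yes _ = refl
    ... | no ¬y = ⊥-elim (¬y y)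

    patch-out : ∀ {w} → ¬ Y w → patch Y? π σ w ≡ σ w
    patch-out {w} ¬y with Y? w
    ... | yes y = ⊥-elim (¬y y)
    ... | no _ = refl

    pairingOn-patch : ∀ {K Z} → (∀ {w} → Z w → ¬ Y w) → PairingOn K Y π → PairingOn K Z σ
              → PairingOn K (Y ∪ Z) (patch Y? π σ)
    pairingOn-patch Z∩Y=∅ P R = pairingOn-∪ (pairingOn-≗ (λ y → sym (patch-in y)) P)
                                      (pairingOn-≗ (λ z → sym (patch-out (Z∩Y=∅ z))) R)

  module _ {K : Graph N} {M : Fin N → Fin N → Bool} (pm : IsPerfectMatching K M) where

    private
      mate-of : ∀ w {b} → V K w ≡ b → Fin N
      mate-of w {true}  vw = proj₁ (proj₂ (proj₂ pm) w vw)
      mate-of w {false} _  = w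

      mate-of-matched : ∀ w {b} (vw : V K w ≡ b) → b ≡ true
                      → M w (mate-of w vw) ≡ true × (∀ z → M w z ≡ true → z ≡ mate-of w vw)
      mate-of-matched w {true} vw _ = proj₂ (proj₂ (proj₂ pm) w vw)

    partner : Fin N → Fin N
    partner w = mate-of w refl

    partner-matched : ∀ {w} → V K w ≡ true
                    → M w (partner w) ≡ true × (∀ z → M w z ≡ true → z ≡ partner w)
    partner-matched {w} = mate-of-matched w refl

    partner-pairing : PerfectPairing K partner
    partner-pairing = record
      { adjacent   = λ vw → proj₁ pm _ _ (proj₁ (partner-matched vw))
      ; closed     = λ {w} vw → E-Vʳ K w _ (proj₁ pm _ _ (proj₁ (partner-matched vw)))
      ; involutive = λ {w} vw →
          let m = trans (proj₁ (proj₂ pm) (partner w) w) (proj₁ (partner-matched vw))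
          in sym (proj₂ (partner-matched (E-V K _ w (proj₁ pm _ _ m))) w m)
      }

  matchingCovered⇒edgeCovered : ∀ {K : Graph N} → MatchingCovered K → EdgeCovered K
  matchingCovered⇒edgeCovered {K} (_ , _ , covered) {x} {y} e with covered x y e
  ... | M , pm , mxy = partner pm , partner-pairing pm , sym (proj₂ (partner-matched pm (E-V K x y e)) y mxy)

  matchingOf : Graph N → (Fin N → Fin N) → Fin N → Fin N → Bool
  matchingOf K π x y = V K x ∧ does (π x ≟ y)

  module _ {K : Graph N} {π : Fin N → Fin N} (P : PerfectPairing K π) where

    matchingOf-sound : ∀ {x y} → matchingOf K π x y ≡ true → V K x ≡ true × π x ≡ y
    matchingOf-sound {x} {y} h with V K x | π x ≟ y
    ... | true | yes πx≡y = refl , πx≡y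

    matchingOf-mate : ∀ {x} → V K x ≡ true → matchingOf K π x (π x) ≡ true
    matchingOf-mate {x} vx rewrite vx with π x ≟ π x
    ... | yes _ = refl
    ... | no πx≢πx = ⊥-elim (πx≢πx refl)

    matchingOf-sym : ∀ x y → matchingOf K π x y ≡ matchingOf K π y x
    matchingOf-sym x y with V K x in vx | V K y in vy
    ... | true  | true  = does-⇔ (mk⇔ (mate-swap P vx) (mate-swap P vy)) (π x ≟ y) (π y ≟ x)
    ... | true  | false =
      dec-false (π x ≟ y) λ πx≡y → true≢false (trans (sym (subst (Vertex K) πx≡y (closed P vx))) vy)
    ... | false | true  =
      sym (dec-false (π y ≟ x) λ πy≡x → true≢false (trans (sym (subst (Vertex K) πy≡x (closed P vy))) vx))
    ... | false | false = refl

    pairing⇒perfectMatching : IsPerfectMatching K (matchingOf K π)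
    pairing⇒perfectMatching =
        (λ x y h → let (vx , πx≡y) = matchingOf-sound h in subst (λ t → E K x t ≡ true) πx≡y (adjacent P vx))
      , matchingOf-sym
      , λ v vv → π v , matchingOf-mate vv , λ w h → sym (proj₂ (matchingOf-sound h))

  edgeCovered⇒matchingCovered : ∀ {K : Graph N} → Connected K → Nontrivial K → EdgeCovered K → MatchingCovered K
  edgeCovered⇒matchingCovered {K} conn nt cov = conn , nt , λ x y e →
    let (π , P , πx≡y) = cov e
    in matchingOf K π , pairing⇒perfectMatching P
     , subst (λ t → matchingOf K π x t ≡ true) πx≡y (matchingOf-mate P (E-V K x y e))

  pendant-edge-isolated : ∀ {K : Graph N} → EdgeCovered K → ∀ {w x z}
    → E K w x ≡ true → (∀ {t} → E K w t ≡ true → t ≡ x) → E K x z ≡ true → z ≡ w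
  pendant-edge-isolated {K} cov {w} wx only xz with cov xz
  ... | π , P , πx≡z = trans (sym πx≡z) (mate-swap P (E-V K w _ wx) (only (adjacent P (E-V K w _ wx))))

  neighbour-besides : ∀ {K : Graph N} → EdgeCovered K → ∀ {w x z}
    → E K w x ≡ true → E K x z ≡ true → z ≢ w → Σ (Fin N) λ t → E K w t ≡ true × t ≢ x
  neighbour-besides {K} cov {w} {x} wx xz z≢w with any? (λ t → (E K w t Bool.≟ true) ×-dec ¬? (t ≟ x))
  ... | yes found = found
  ... | no none = ⊥-elim (z≢w (pendant-edge-isolated cov wx only xz))
    where
      only : ∀ {t} → E K w t ≡ true → t ≡ x
      only {t} wt = decidable-stable (t ≟ x) λ t≢x → none (t , wt , t≢x)

  sameEdge? : ∀ (u v x y : Fin N) → Dec (SameEdge u v x y)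
  sameEdge? u v x y = ((x ≟ u) ×-dec (y ≟ v)) ⊎-dec ((x ≟ v) ×-dec (y ≟ u))

  deleteEdge : (G : Graph N) (u v : Fin N) → Σ (Graph N) (DeleteEdge G u v)
  deleteEdge G u v = H , (λ _ → mk⇔ id id) , λ x y → mk⇔ (kept x y) (keep x y)
    where
      H : Graph N
      H = record
        { V     = V G
        ; E     = λ x y → E G x y ∧ not (does (sameEdge? u v x y))
        ; E-sym = λ x y → cong₂ _∧_ (E-sym G x y)
                    (cong not (does-⇔ (mk⇔ sameEdge-swap sameEdge-swap) (sameEdge? u v x y) (sameEdge? u v y x)))
        ; E-irr = λ x → cong (_∧ _) (E-irr G x)
        ; E-V   = λ x y e → E-V G x y (∧-trueˡ e)
        }
      kept : ∀ x y → E H x y ≡ true → E G x y ≡ true × ¬ SameEdge u v x y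
      kept x y e = ∧-trueˡ e , λ same →
        true≢false (sym (∧-trueʳ (subst (λ b → E G x y ∧ not b ≡ true) (dec-true (sameEdge? u v x y) same) e)))
      keep : ∀ x y → E G x y ≡ true × ¬ SameEdge u v x y → E H x y ≡ true
      keep x y (e , ¬same) rewrite e | dec-false (sameEdge? u v x y) ¬same = refl

even-or-odd : ∀ n → Σ ℕ λ j → n ≡ j + j ⊎ n ≡ suc (j + j)
even-or-odd zero = 0 , inj₁ refl
even-or-odd (suc n) with even-or-odd n
... | j , inj₁ refl = j , inj₂ refl
... | j , inj₂ refl = suc j , inj₁ (cong suc (sym (+-suc j j)))

half-≤ : ∀ j c → j + j ≤ suc (c + c) → j ≤ c
half-≤ zero    c       _  = z≤n
half-≤ (suc j) zero    le rewrite +-suc j j with le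
... | s≤s ()
half-≤ (suc j) (suc c) le rewrite +-suc j j | +-suc c c = s≤s (half-≤ j c (≤-pred (≤-pred le)))

Neighbours : ℕ → ℕ → Set
Neighbours i j = j ≡ suc i ⊎ i ≡ suc j

-- Along a path p₀ … p₂c₊₁, outerMate pairs p₀p₁, p₂p₃, … and innerMate pairs p₁p₂, p₃p₄, …,
-- covering the inner vertices.
outerMate : ℕ → ℕ
outerMate zero = 1
outerMate (suc zero) = 0
outerMate (suc (suc i)) = suc (suc (outerMate i))

innerMate : ℕ → ℕ
innerMate zero = zero
innerMate (suc i) = suc (outerMate i)

outerMate-involutive : ∀ i → outerMate (outerMate i) ≡ i
outerMate-involutive zero = refl
outerMate-involutive (suc zero) = refl
outerMate-involutive (suc (suc i)) = cong (suc ∘ suc) (outerMate-involutive i)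

innerMate-involutive : ∀ i → innerMate (innerMate i) ≡ i
innerMate-involutive zero = refl
innerMate-involutive (suc i) = cong suc (outerMate-involutive i)

outerMate-even : ∀ j → outerMate (j + j) ≡ suc (j + j)
outerMate-even zero = refl
outerMate-even (suc j) rewrite +-suc j j = cong (suc ∘ suc) (outerMate-even j)

outerMate-odd : ∀ j → outerMate (suc (j + j)) ≡ j + j
outerMate-odd zero = refl
outerMate-odd (suc j) rewrite +-suc j j = cong (suc ∘ suc) (outerMate-odd j)

outerMate-neighbours : ∀ i → Neighbours i (outerMate i)
outerMate-neighbours zero = inj₁ refl
outerMate-neighbours (suc zero) = inj₂ refl
outerMate-neighbours (suc (suc i)) with outerMate-neighbours i
... | inj₁ e = inj₁ (cong (suc ∘ suc) e)
... | inj₂ e = inj₂ (cong (suc ∘ suc) e)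

innerMate-neighbours : ∀ {i} → 1 ≤ i → Neighbours i (innerMate i)
innerMate-neighbours {suc i} _ with outerMate-neighbours i
... | inj₁ e = inj₁ (cong suc e)
... | inj₂ e = inj₂ (cong suc e)

outerMate-≤ : ∀ c {i} → i ≤ suc (c + c) → outerMate i ≤ suc (c + c)
outerMate-≤ c {i} le with even-or-odd i
... | j , inj₁ refl rewrite outerMate-even j = s≤s (+-mono-≤ (half-≤ j c le) (half-≤ j c le))
... | j , inj₂ refl rewrite outerMate-odd j = ≤-trans (n≤1+n _) le

innerMate-inside : ∀ c {i} → 1 ≤ i → i < suc (c + c) → 1 ≤ innerMate i × innerMate i < suc (c + c)
innerMate-inside zero    {suc i} _ (s≤s ())
innerMate-inside (suc c) {suc i} _ (s≤s i<) rewrite +-suc c c = s≤s z≤n , s≤s (s≤s (outerMate-≤ c (≤-pred i<)))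

module _ {N : ℕ} where

  Image : (ℕ → Fin N) → Pred ℕ 0ℓ → Pred (Fin N) 0ℓ
  Image p R w = Σ ℕ λ i → R i × p i ≡ w

  OnPath : (ℕ → Fin N) → ℕ → Pred (Fin N) 0ℓ
  OnPath p n = Image p (_≤ n)

  Inside : (ℕ → Fin N) → ℕ → Pred (Fin N) 0ℓ
  Inside p n = Image p λ i → 1 ≤ i × i < n

  PathEdge : (ℕ → Fin N) → ℕ → Fin N → Fin N → Set
  PathEdge p n x y = ∃ λ i → i < n × SameEdge (p i) (p (suc i)) x y

  onPath? : ∀ p n w → Dec (OnPath p n w)
  onPath? p n w = map′ (λ (i , i<1+n , e) → i , ≤-pred i<1+n , e) (λ (i , i≤n , e) → i , s≤s i≤n , e)
                       (anyUpTo? (λ i → p i ≟ w) (suc n))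

  pathEdge? : ∀ p n x y → Dec (PathEdge p n x y)
  pathEdge? p n x y = anyUpTo? (λ i → sameEdge? (p i) (p (suc i)) x y) n

  inside? : ∀ p n w → Dec (Inside p n w)
  inside? p n w = map′ (λ (i , i<n , 1≤i , e) → i , (1≤i , i<n) , e) (λ (i , (1≤i , i<n) , e) → i , i<n , 1≤i , e)
                       (anyUpTo? (λ i → (1 ≤? i) ×-dec (p i ≟ w)) n)

  inside⇒onPath : ∀ {p n w} → Inside p n w → OnPath p n w
  inside⇒onPath (i , (_ , i<n) , e) = i , <⇒≤ i<n , e

  pathMate : (ℕ → Fin N) → ℕ → (ℕ → ℕ) → Fin N → Fin N
  pathMate p n f w with onPath? p n w
  ... | yes (i , _ , _) = p (f i)
  ... | no _ = w

  record Path (K : Graph N) (p : ℕ → Fin N) (n : ℕ) : Set where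
    field
      injective : ∀ {i j} → i ≤ n → j ≤ n → p i ≡ p j → i ≡ j
      edge      : ∀ {i} → i < n → E K (p i) (p (suc i)) ≡ true
  open Path public

  record BarePath (K : Graph N) (p : ℕ → Fin N) (n : ℕ) : Set where
    field
      path     : Path K p n
      interior : ∀ {i z} → suc i < n → E K (p (suc i)) z ≡ true → z ≡ p i ⊎ z ≡ p (suc (suc i))
  open BarePath public

  module _ {K : Graph N} {p : ℕ → Fin N} where

    path-vertexˡ : ∀ {n} → Path K p n → ∀ {i} → i < n → V K (p i) ≡ true
    path-vertexˡ P i< = E-V K _ _ (edge P i<)

    path-vertexʳ : ∀ {n} → Path K p n → ∀ {i} → i < n → V K (p (suc i)) ≡ true
    path-vertexʳ P i< = E-Vʳ K _ _ (edge P i<)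

    path-vertex : ∀ {n} → Path K p (suc n) → ∀ {i} → i ≤ suc n → V K (p i) ≡ true
    path-vertex P {i} i≤ with m≤n⇒m<n∨m≡n i≤
    ... | inj₁ i< = path-vertexˡ P i<
    ... | inj₂ refl = path-vertexʳ P ≤-refl

    path-reach : ∀ {n} → Path K p n → ∀ {i} → i ≤ n → Reach K (p 0) (p i)
    path-reach P {zero} _ = here
    path-reach P {suc i} i< = reach-trans (path-reach P (<⇒≤ i<)) (step (edge P i<) here)

    path-sameEdge : ∀ {n} → Path K p n → ∀ {i i′ j k} → i ≤ n → i′ ≤ n → j ≤ n → k ≤ n
                  → SameEdge (p i) (p i′) (p j) (p k) → SameEdge i i′ j k
    path-sameEdge P i≤ i′≤ j≤ k≤ (inj₁ (e , e′)) = inj₁ (injective P j≤ i≤ e , injective P k≤ i′≤ e′)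
    path-sameEdge P i≤ i′≤ j≤ k≤ (inj₂ (e , e′)) = inj₂ (injective P j≤ i′≤ e , injective P k≤ i≤ e′)

    path-neighbours : ∀ {n} → Path K p n → ∀ {i j} → i ≤ n → j ≤ n → Neighbours i j → E K (p i) (p j) ≡ true
    path-neighbours P _   j≤ (inj₁ refl) = edge P j≤
    path-neighbours P i≤ _   (inj₂ refl) = edge-sym K (edge P i≤)

    pathMate-at : ∀ {n} → Path K p n → ∀ f {i} → i ≤ n → pathMate p n f (p i) ≡ p (f i)
    pathMate-at {n} P f {i} i≤ with onPath? p n (p i)
    ... | yes (j , j≤ , e) = cong (p ∘ f) (injective P j≤ i≤ e)
    ... | no ∉ = ⊥-elim (∉ (i , i≤ , refl))

    pathMate-pairing : ∀ {n} → Path K p n → ∀ f (R : Pred ℕ 0ℓ) → (∀ {i} → R i → i ≤ n)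
      → (∀ {i} → R i → R (f i)) → (∀ {i} → R i → f (f i) ≡ i) → (∀ {i} → R i → Neighbours i (f i))
      → PairingOn K (Image p R) (pathMate p n f)
    pathMate-pairing P f R R⊆ f-R f-inv f-nbr = record
      { adjacent   = λ { (i , r , refl) → subst (λ t → E K (p i) t ≡ true) (sym (pathMate-at P f (R⊆ r)))
                                            (path-neighbours P (R⊆ r) (R⊆ (f-R r)) (f-nbr r)) }
      ; closed     = λ { (i , r , refl) → f i , f-R r , sym (pathMate-at P f (R⊆ r)) }
      ; involutive = λ { (i , r , refl) → trans (cong (pathMate p _ f) (pathMate-at P f (R⊆ r)))
                                            (trans (pathMate-at P f (R⊆ (f-R r))) (cong p (f-inv r))) }
      }

    outer-pairing : ∀ {c} → Path K p (suc (c + c)) → PairingOn K (OnPath p (suc (c + c))) (pathMate p (suc (c + c)) outerMate)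
    outer-pairing {c} P = pathMate-pairing P outerMate _ id (outerMate-≤ c) (λ {i} _ → outerMate-involutive i)
                                           (λ {i} _ → outerMate-neighbours i)

    inner-pairing : ∀ {c} → Path K p (suc (c + c)) → PairingOn K (Inside p (suc (c + c))) (pathMate p (suc (c + c)) innerMate)
    inner-pairing {c} P = pathMate-pairing P innerMate _ (λ (_ , i<) → <⇒≤ i<) (λ (1≤i , i<) → innerMate-inside c 1≤i i<)
                                           (λ {i} _ → innerMate-involutive i) (λ (1≤i , _) → innerMate-neighbours 1≤i)

  module _ {K : Graph N} {p : ℕ → Fin N} {n : ℕ} (B : BarePath K p n) {π : Fin N → Fin N} (P : PerfectPairing K π) where

    forced-step : ∀ {i} → suc (suc (suc i)) ≤ n → π (p i) ≡ p (suc i) → π (p (suc (suc i))) ≡ p (suc (suc (suc i)))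
    forced-step {i} 3+i≤n πpᵢ with interior B 3+i≤n (adjacent P (path-vertexʳ (path B) 2+i<n))
      where 2+i<n = ≤-trans (n≤1+n _) 3+i≤n
    ... | inj₂ e = e
    ... | inj₁ e with injective (path B) i≤n (<⇒≤ 3+i≤n) pᵢ≡pᵢ₊₂
      where
        i≤n = ≤-trans (n≤1+n _) (≤-trans (n≤1+n _) (<⇒≤ 3+i≤n))
        pᵢ≡pᵢ₊₂ : p i ≡ p (suc (suc i))
        pᵢ≡pᵢ₊₂ = trans (sym (mate-swap P (path-vertexˡ (path B) (≤-trans (n≤1+n _) (<⇒≤ 3+i≤n))) πpᵢ))
                        (mate-swap P (path-vertexʳ (path B) (≤-trans (n≤1+n _) 3+i≤n)) e)
    ...   | ()

    pairs-forced : π (p 0) ≡ p 1 → ∀ j → suc (j + j) ≤ n → π (p (j + j)) ≡ p (suc (j + j))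
    pairs-forced πp₀ zero _ = πp₀
    pairs-forced πp₀ (suc j) le rewrite +-suc j j =
      forced-step le (pairs-forced πp₀ j (≤-trans (n≤1+n _) (≤-trans (n≤1+n _) le)))

    first-step : 2 ≤ n → π (p 0) ≢ p 1 → π (p 1) ≡ p 2
    first-step 2≤n πp₀≢p₁ with interior B {0} 2≤n (adjacent P (path-vertexʳ (path B) 1<n))
      where 1<n = ≤-trans (s≤s z≤n) 2≤n
    ... | inj₂ e = e
    ... | inj₁ e = ⊥-elim (πp₀≢p₁ (mate-swap P (path-vertexʳ (path B) (≤-trans (s≤s z≤n) 2≤n)) e))

  outer-forced : ∀ {K p c π} → BarePath K p (suc (c + c)) → PerfectPairing K π → π (p 0) ≡ p 1
               → ∀ {i} → i ≤ suc (c + c) → π (p i) ≡ p (outerMate i)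
  outer-forced {p = p} {c} B P πp₀ {i} i≤ with even-or-odd i
  ... | j , inj₁ refl = trans (pairs-forced B P πp₀ j (s≤s (+-mono-≤ (half-≤ j c i≤) (half-≤ j c i≤))))
                              (cong p (sym (outerMate-even j)))
  ... | j , inj₂ refl = trans (mate-swap P (path-vertexˡ (path B) i≤) (pairs-forced B P πp₀ j i≤))
                              (cong p (sym (outerMate-odd j)))

  bare-tail : ∀ {K p n} → BarePath K p (suc (suc n)) → BarePath K (p ∘ suc) n
  bare-tail {n = n} B = record
    { path     = record
      { injective = λ i≤ j≤ e →
          suc-injective (injective (path B) (s≤s (≤-trans i≤ (n≤1+n n))) (s≤s (≤-trans j≤ (n≤1+n n))) e)
      ; edge      = λ i< → edge (path B) (s≤s (≤-trans i< (n≤1+n n)))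
      }
    ; interior = λ i< → interior B (s≤s (≤-trans i< (n≤1+n n)))
    }

  inner-forced : ∀ {K p c π} → BarePath K p (suc (c + c)) → 1 ≤ c → PerfectPairing K π → π (p 0) ≢ p 1
               → ∀ {i} → 1 ≤ i → i < suc (c + c) → π (p i) ≡ p (innerMate i)
  inner-forced {K} {p} {suc c} B _ P πp₀≢p₁ {suc i} _ (s≤s i<) =
    outer-forced {c = c} tail P (first-step B P (s≤s (s≤s z≤n)) πp₀≢p₁) (subst (i ≤_) (+-suc c c) (≤-pred i<))
    where
      tail : BarePath K (p ∘ suc) (suc (c + c))
      tail = subst (BarePath K (p ∘ suc)) (+-suc c c) (bare-tail B)

  ∸-suc : ∀ {n k} → suc k ≤ n → n ∸ k ≡ suc (n ∸ suc k)
  ∸-suc (s≤s k≤n) = +-∸-assoc 1 k≤n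

  reverse-bare : ∀ {K p n} → BarePath K p n → BarePath K (λ i → p (n ∸ i)) n
  reverse-bare {K} {p} {n} B = record
    { path     = record
      { injective = λ {i} {j} i≤ j≤ e → ∸-cancelˡ-≡ i≤ j≤ (injective (path B) (m∸n≤m n i) (m∸n≤m n j) e)
      ; edge      = λ {i} i< → subst (λ t → E K (p t) (p (n ∸ suc i)) ≡ true) (sym (∸-suc i<))
                                     (edge-sym K (edge (path B) (∸-monoʳ-< (s≤s z≤n) i<)))
      }
    ; interior = λ {i} {z} 2+i≤n e →
        let n-i-1 = ∸-suc 2+i≤n
            n-i   = trans (∸-suc (<⇒≤ 2+i≤n)) (cong suc n-i-1)
        in [ inj₂ , (λ z≡ → inj₁ (trans z≡ (cong p (sym n-i)))) ]′
             (interior B (subst (_≤ n) n-i (m∸n≤m n i)) (subst (λ t → E K (p t) z ≡ true) n-i-1 e))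
    }

  private
    module Gap {K H : Graph N} {p : ℕ → Fin N} {n : ℕ} (B : BarePath K p n) (3≤n : 3 ≤ n) {x y : Fin N} {i : ℕ}
               (i<n : i < n) (xy : SameEdge (p i) (p (suc i)) x y) (K-xy : DeleteEdge K x y H) where

      2≤n : 2 ≤ n
      2≤n = ≤-trans (n≤1+n 2) 3≤n

      1≤n : 1 ≤ n
      1≤n = ≤-trans (n≤1+n 1) 2≤n

      distinct : ∀ {j k} → j ≤ n → k ≤ n → j ≢ k → p j ≢ p k
      distinct j≤ k≤ j≢k e = j≢k (injective (path B) j≤ k≤ e)

      kept : ∀ {a b} → E K a b ≡ true → ¬ SameEdge (p i) (p (suc i)) a b → E H a b ≡ true
      kept e ¬s = from (proj₂ K-xy _ _) (e , λ s → ¬s (sameEdge-trans xy s))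

      path-kept : ∀ {j k} → j ≤ n → k ≤ n → E K (p j) (p k) ≡ true → ¬ SameEdge i (suc i) j k
                → E H (p j) (p k) ≡ true
      path-kept j≤ k≤ e ¬s = kept e λ s → ¬s (path-sameEdge (path B) (<⇒≤ i<n) i<n j≤ k≤ s)

      sole-predecessor : ∀ {j t} → suc j < n → SameEdge i (suc i) (suc j) (suc (suc j))
                       → E H (p (suc j)) t ≡ true → t ≡ p j
      sole-predecessor j< lost e with to (proj₂ K-xy _ _) e
      ... | e′ , ¬xy with interior B j< e′
      ...   | inj₁ t≡ = t≡
      ...   | inj₂ refl = ⊥-elim (¬xy (sameEdge-trans (sameEdge-sym xy) (sameEdge-map p lost)))

      sole-successor : ∀ {j t} → suc j < n → SameEdge i (suc i) (suc j) j
                     → E H (p (suc j)) t ≡ true → t ≡ p (suc (suc j))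
      sole-successor j< lost e with to (proj₂ K-xy _ _) e
      ... | e′ , ¬xy with interior B j< e′
      ...   | inj₂ t≡ = t≡
      ...   | inj₁ refl = ⊥-elim (¬xy (sameEdge-trans (sameEdge-sym xy) (sameEdge-map p lost)))

  gapped-bare-path : ∀ {K H : Graph N} {p n x y z i} → BarePath K p n → 3 ≤ n → E K (p 0) z ≡ true → z ≢ p 1
    → i < n → SameEdge (p i) (p (suc i)) x y → DeleteEdge K x y H → ¬ EdgeCovered H
  gapped-bare-path {K} {H} {p} {n} {x} {y} {i = zero} B 3≤n _ _ i<n xy K-xy cov =
    distinct 3≤n 1≤n (λ ()) (pendant-edge-isolated cov
      (path-kept 1≤n 2≤n (edge (path B) 2≤n) λ { (inj₁ (() , _)) ; (inj₂ (_ , ())) })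
      (sole-successor 2≤n (inj₂ (refl , refl)))
      (path-kept 2≤n 3≤n (edge (path B) 3≤n) λ { (inj₁ (() , _)) ; (inj₂ (() , _)) }))
    where open Gap {K} {H} {p} {n} B 3≤n {x} {y} i<n xy K-xy
  gapped-bare-path {K} {H} {p} {n} {x} {y} {z} {i = suc zero} B 3≤n p₀z z≢p₁ i<n xy K-xy cov =
    z≢p₁ (pendant-edge-isolated cov
      (path-kept 1≤n z≤n (edge-sym K (edge (path B) 1≤n)) λ { (inj₁ (_ , ())) ; (inj₂ (() , _)) })
      (sole-predecessor 2≤n (inj₁ (refl , refl)))
      (kept p₀z λ { (inj₁ (e , _)) → distinct z≤n 1≤n (λ ()) e ; (inj₂ (e , _)) → distinct z≤n 2≤n (λ ()) e }))
    where open Gap {K} {H} {p} {n} B 3≤n {x} {y} i<n xy K-xy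
  gapped-bare-path {K} {H} {p} {n} {x} {y} {i = suc (suc i)} B 3≤n _ _ i<n xy K-xy cov =
    distinct i≤n i+2≤n (λ ()) (pendant-edge-isolated cov
      (path-kept i+2≤n i+1≤n (edge-sym K (edge (path B) i+2≤n)) λ { (inj₁ (_ , ())) ; (inj₂ (() , _)) })
      (sole-predecessor i<n (inj₁ (refl , refl)))
      (path-kept i+1≤n i≤n (edge-sym K (edge (path B) i+1≤n)) λ { (inj₁ (() , _)) ; (inj₂ (() , _)) }))
    where
      open Gap {K} {H} {p} {n} B 3≤n {x} {y} i<n xy K-xy
      i+2≤n = <⇒≤ i<n
      i+1≤n = ≤-trans (n≤1+n _) i+2≤n
      i≤n = ≤-trans (n≤1+n _) i+1≤n

  bare-delete : ∀ {K H : Graph N} {p n x y} → BarePath K p n → DeleteEdge K x y H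
              → (∀ {i} → i < n → ¬ SameEdge x y (p i) (p (suc i))) → BarePath H p n
  bare-delete B K-xy off = record
    { path     = record { injective = injective (path B)
                        ; edge      = λ i< → from (proj₂ K-xy _ _) (edge (path B) i< , off i<) }
    ; interior = λ i< e → interior B i< (proj₁ (to (proj₂ K-xy _ _) e))
    }

  neighbours-pathEdge : ∀ {p : ℕ → Fin N} {n i j} → i ≤ n → j ≤ n → Neighbours i j → PathEdge p n (p i) (p j)
  neighbours-pathEdge {i = i} _ j≤n (inj₁ refl) = i , j≤n , inj₁ (refl , refl)
  neighbours-pathEdge {j = j} i≤n _ (inj₂ refl) = j , i≤n , inj₂ (refl , refl)

  end-neighbour-besides : ∀ {K p n} → EdgeCovered K → Path K p n → 2 ≤ n
                        → Σ (Fin N) λ t → E K (p 0) t ≡ true × t ≢ p 1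
  end-neighbour-besides cov P 2≤n =
    neighbour-besides cov (edge P (≤-trans (s≤s z≤n) 2≤n)) (edge P 2≤n) λ e → 2≢0 (injective P 2≤n z≤n e)
    where
      2≢0 : 2 ≢ 0
      2≢0 ()

  pathEdge-neighbour : ∀ {K p n k z} → Path K p n → k ≤ n → PathEdge p n (p k) z
                     → Σ ℕ λ j → Neighbours k j × z ≡ p j
  pathEdge-neighbour P k≤n (i , i<n , inj₁ (e , refl)) =
    suc i , inj₁ (cong suc (injective P (<⇒≤ i<n) k≤n (sym e))) , refl
  pathEdge-neighbour P k≤n (i , i<n , inj₂ (e , refl)) = i , inj₂ (injective P k≤n i<n e) , refl

  subpath-bare : ∀ {K p n lo hi} → Path K p n → lo ≤ hi → hi ≤ n
    → (∀ {k z} → lo < k → k < hi → E K (p k) z ≡ true → Σ ℕ λ j → Neighbours k j × z ≡ p j)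
    → BarePath K (λ i → p (lo + i)) (hi ∸ lo)
  subpath-bare {K} {p} {n} {lo} {hi} P lo≤hi hi≤n only-neighbours = record
    { path     = record
      { injective = λ {i} {j} i≤ j≤ e → +-cancelˡ-≡ lo i j (injective P (shift-≤ i≤) (shift-≤ j≤) e)
      ; edge      = λ {i} i< → subst (λ t → E K (p (lo + i)) (p t) ≡ true) (sym (+-suc lo i))
                                     (edge P (≤-trans (shift-< i<) hi≤n))
      }
    ; interior = nbrs
    }
    where
      shift-≤ : ∀ {i} → i ≤ hi ∸ lo → lo + i ≤ n
      shift-≤ {i} i≤ = ≤-trans (subst (lo + i ≤_) (m+[n∸m]≡n lo≤hi) (+-monoʳ-≤ lo i≤)) hi≤n
      shift-< : ∀ {i} → i < hi ∸ lo → lo + i < hi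
      shift-< {i} i< = subst (lo + i <_) (m+[n∸m]≡n lo≤hi) (+-monoʳ-< lo i<)
      nbrs : ∀ {i z} → suc i < hi ∸ lo → E K (p (lo + suc i)) z ≡ true → z ≡ p (lo + i) ⊎ z ≡ p (lo + suc (suc i))
      nbrs {i} {z} i+1< e with only-neighbours lo<lo+i+1 (shift-< i+1<) e
        where
          lo<lo+i+1 : lo < lo + suc i
          lo<lo+i+1 = subst (lo <_) (sym (+-suc lo i)) (s≤s (m≤m+n lo i))
      ... | j , inj₁ refl , refl = inj₂ (cong p (sym (+-suc lo (suc i))))
      ... | j , inj₂ lo+i+1≡ , refl = inj₁ (cong p (suc-injective (trans (sym lo+i+1≡) (+-suc lo i))))

alternate : ℕ → Bool → Bool
alternate zero β = β
alternate (suc i) β = not (alternate i β)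

alternate-even : ∀ j β → alternate (j + j) β ≡ β
alternate-even zero β = refl
alternate-even (suc j) β rewrite +-suc j j = trans (not-involutive _) (alternate-even j β)

alternate-odd : ∀ j β → alternate (suc (j + j)) β ≡ not β
alternate-odd j β = cong not (alternate-even j β)

module _ {N : ℕ} where

  path-colouring : ∀ {K : Graph N} {p n c} → ProperColouring K c → Path K p n
                 → ∀ {i} → i ≤ n → c (p i) ≡ alternate i (c (p 0))
  path-colouring pc P {zero}  _  = refl
  path-colouring pc P {suc i} i< =
    trans (¬-not λ e → pc _ _ (edge P i<) (sym e)) (cong not (path-colouring pc P (<⇒≤ i<)))

  odd-path : ∀ {K : Graph N} {p n c} → ProperColouring K c → Path K p n → c (p 0) ≢ c (p n)
           → Σ ℕ λ a → n ≡ suc (a + a)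
  odd-path {n = n} pc P split with even-or-odd n
  ... | a , inj₂ n≡ = a , n≡
  ... | j , inj₁ refl = ⊥-elim (split (sym (trans (path-colouring pc P ≤-refl) (alternate-even j _))))

  record PathSum (G : Graph N) (q : ℕ → Fin N) (m : ℕ) (G′ : Graph N) : Set where
    field
      ear-path : Path G′ q m
      fresh    : ∀ {i} → 1 ≤ i → i < m → V G (q i) ≡ false
      vertices : ∀ w → V G′ w ≡ true ⇔ (V G w ≡ true ⊎ OnPath q m w)
      edges    : ∀ x y → E G′ x y ≡ true ⇔ (E G x y ≡ true ⊎ PathEdge q m x y)

  module _ {G G′ : Graph N} {q : ℕ → Fin N} {m : ℕ} (Q : PathSum G q m G′) where
    open PathSum Q

    old-vertex : ∀ {w} → V G w ≡ true → V G′ w ≡ true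
    old-vertex vw = from (vertices _) (inj₁ vw)

    old-edge : ∀ {x y} → E G x y ≡ true → E G′ x y ≡ true
    old-edge e = from (edges _ _) (inj₁ e)

    old-on-ear : ∀ {i} → i ≤ m → V G (q i) ≡ true → i ≡ 0 ⊎ i ≡ m
    old-on-ear {zero} _ _ = inj₁ refl
    old-on-ear {suc i} i≤m vq with suc i ℕ.≟ m
    ... | yes i≡m = inj₂ i≡m
    ... | no i≢m = ⊥-elim (true≢false (trans (sym vq) (fresh (s≤s z≤n) (≤∧≢⇒< i≤m i≢m))))

    ear-edge-fresh : 2 ≤ m → ∀ {i} → i < m → V G (q i) ≡ false ⊎ V G (q (suc i)) ≡ false
    ear-edge-fresh 2≤m {zero}  _   = inj₂ (fresh ≤-refl 2≤m)
    ear-edge-fresh 2≤m {suc i} i<m = inj₁ (fresh (s≤s z≤n) i<m)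

    ear-edge-new-end : 2 ≤ m → ∀ {k u w} → k < m → SameEdge (q k) (q (suc k)) u w → V G u ≡ false ⊎ V G w ≡ false
    ear-edge-new-end 2≤m k<m (inj₁ (refl , refl)) = ear-edge-fresh 2≤m k<m
    ear-edge-new-end 2≤m k<m (inj₂ (refl , refl)) = Sum.swap (ear-edge-fresh 2≤m k<m)

    old-edge-back : 2 ≤ m → ∀ {x y} → V G x ≡ true → V G y ≡ true → E G′ x y ≡ true → E G x y ≡ true
    old-edge-back 2≤m {x} {y} vx vy e with to (edges x y) e
    ... | inj₁ e′ = e′
    ... | inj₂ (i , i<m , same) with ear-edge-new-end 2≤m i<m same
    ...   | inj₁ fx = ⊥-elim (true≢false (trans (sym vx) fx))
    ...   | inj₂ fy = ⊥-elim (true≢false (trans (sym vy) fy))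

    ear-bare : BarePath G′ q m
    ear-bare = record { path = ear-path ; interior = nbrs }
      where
        nbrs : ∀ {i z} → suc i < m → E G′ (q (suc i)) z ≡ true → z ≡ q i ⊎ z ≡ q (suc (suc i))
        nbrs {i} i< e with to (edges _ _) e
        ... | inj₁ e′ = ⊥-elim (true≢false (trans (sym (E-V G _ _ e′)) (fresh (s≤s z≤n) i<)))
        ... | inj₂ (k , k<m , inj₁ (e₁ , refl)) with injective ear-path (<⇒≤ i<) (<⇒≤ k<m) e₁
        ...   | refl = inj₂ refl
        nbrs {i} i< e | inj₂ (k , k<m , inj₂ (e₁ , refl)) with injective ear-path (<⇒≤ i<) k<m e₁
        ...   | refl = inj₁ refl

    sum-connected : Connected G → V G (q 0) ≡ true → Connected G′
    sum-connected conn vq₀ u w vu vw = reach-trans (to-q₀ vu) (reach-sym (to-q₀ vw))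
      where
        to-q₀ : ∀ {t} → V G′ t ≡ true → Reach G′ t (q 0)
        to-q₀ {t} vt with to (vertices t) vt
        ... | inj₁ vt′ = reach-map id (λ e → step (old-edge e) here) (conn t (q 0) vt′ vq₀)
        ... | inj₂ (i , i≤m , refl) = reach-sym (path-reach ear-path i≤m)

    sum-nontrivial : Nontrivial G → Nontrivial G′
    sum-nontrivial (u , w , u≢w , vu , vw) = u , w , u≢w , old-vertex vu , old-vertex vw

  module _ {G G′ : Graph N} {q : ℕ → Fin N} {b : ℕ} (Q : PathSum G q (suc (b + b)) G′) where
    open PathSum Q

    private
      m = suc (b + b)

    ear-colouring : (Fin N → Bool) → Fin N → Bool
    ear-colouring c w with onPath? q m w
    ... | yes (i , _ , _) = alternate i (c (q 0))
    ... | no _ = c w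

    module _ {c : Fin N → Bool} (pc : ProperColouring G c) (q₀|qₘ : c (q 0) ≢ c (q m)) where

      ear-colouring-ear : ∀ {i} → i ≤ m → ear-colouring c (q i) ≡ alternate i (c (q 0))
      ear-colouring-ear {i} i≤m with onPath? q m (q i)
      ... | yes (j , j≤m , e) = cong (λ k → alternate k (c (q 0))) (injective ear-path j≤m i≤m e)
      ... | no ∉ = ⊥-elim (∉ (i , i≤m , refl))

      ear-colouring-old : ∀ {w} → V G w ≡ true → ear-colouring c w ≡ c w
      ear-colouring-old {w} vw with onPath? q m w
      ... | no _ = refl
      ... | yes (i , i≤m , refl) with old-on-ear Q i≤m vw
      ...   | inj₁ refl = refl
      ...   | inj₂ refl = trans (alternate-odd b (c (q 0))) (sym (¬-not λ e → q₀|qₘ (sym e)))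

      ear-colouring-proper : ProperColouring G′ (ear-colouring c)
      ear-colouring-proper u w e with to (edges u w) e
      ... | inj₁ e′ rewrite ear-colouring-old (E-V G u w e′) | ear-colouring-old (E-Vʳ G u w e′) = pc u w e′
      ... | inj₂ (k , k<m , inj₁ (refl , refl))
            rewrite ear-colouring-ear (<⇒≤ k<m) | ear-colouring-ear k<m = not-¬ refl
      ... | inj₂ (k , k<m , inj₂ (refl , refl))
            rewrite ear-colouring-ear (<⇒≤ k<m) | ear-colouring-ear k<m = λ h → not-¬ refl (sym h)

    sum-bipartite : Bipartite G → DifferentParts G (q 0) (q m) → Bipartite G′
    sum-bipartite (c , pc) split = ear-colouring c , ear-colouring-proper pc (split c pc)

module _ {N : ℕ} where

  module ParallelEar {G G′ : Graph N} (mmG : MinimalMatchingCovered G)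
    {s : ℕ → Fin N} {a : ℕ} (S : BarePath G s (suc (a + a))) (s₀≁sₙ : E G (s 0) (s (suc (a + a))) ≡ false)
    {q : ℕ → Fin N} {b : ℕ} (Q : PathSum G q (suc (b + b)) G′) (1≤b : 1 ≤ b)
    (s₀≡q₀ : s 0 ≡ q 0) (sₙ≡qₘ : s (suc (a + a)) ≡ q (suc (b + b))) where

    open PathSum Q

    private
      n = suc (a + a)
      m = suc (b + b)
      covG = matchingCovered⇒edgeCovered (proj₁ mmG)

    1≤a : 1 ≤ a
    1≤a = ≤∧≢⇒< z≤n λ 0≡a →
      true≢false (trans (sym (subst (λ k → E G (s 0) (s (suc (k + k))) ≡ true) 0≡a (edge (path S) (s≤s z≤n)))) s₀≁sₙ)

    3≤n : 3 ≤ n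
    3≤n = s≤s (+-mono-≤ 1≤a 1≤a)

    3≤m : 3 ≤ m
    3≤m = s≤s (+-mono-≤ 1≤b 1≤b)

    2≤m : 2 ≤ m
    2≤m = ≤-trans (n≤1+n 2) 3≤m

    s-old : ∀ {i} → i ≤ n → V G (s i) ≡ true
    s-old = path-vertex (path S)

    q₀-old : V G (q 0) ≡ true
    q₀-old = subst (λ w → V G w ≡ true) s₀≡q₀ (s-old z≤n)

    qₘ-old : V G (q m) ≡ true
    qₘ-old = subst (λ w → V G w ≡ true) sₙ≡qₘ (s-old ≤-refl)

    new≢old : ∀ {u w} → V G u ≡ false → V G w ≡ true → u ≢ w
    new≢old fu vw refl = true≢false (trans (sym vw) fu)

    s≡q : ∀ {i j} → i ≤ n → j ≤ m → s i ≡ q j → (i ≡ 0 × j ≡ 0) ⊎ (i ≡ n × j ≡ m)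
    s≡q i≤n j≤m e with old-on-ear Q j≤m (subst (λ w → V G w ≡ true) e (s-old i≤n))
    ... | inj₁ refl = inj₁ (injective (path S) i≤n z≤n (trans e (sym s₀≡q₀)) , refl)
    ... | inj₂ refl = inj₂ (injective (path S) i≤n ≤-refl (trans e (sym sₙ≡qₘ)) , refl)

    inside-s-off-q : ∀ {w} → Inside s n w → ¬ OnPath q m w
    inside-s-off-q (i , (1≤i , i<n) , refl) (j , j≤m , e) with s≡q (<⇒≤ i<n) j≤m (sym e)
    ... | inj₁ (refl , _) = ⊥-elim (<-irrefl refl 1≤i)
    ... | inj₂ (refl , _) = ⊥-elim (<-irrefl refl i<n)

    old-on-q-on-s : ∀ {w} → OnPath q m w → V G w ≡ true → OnPath s n w
    old-on-q-on-s (j , j≤m , refl) vw with old-on-ear Q j≤m vw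
    ... | inj₁ refl = 0 , z≤n , s₀≡q₀
    ... | inj₂ refl = n , ≤-refl , sₙ≡qₘ

    on-q-split : ∀ {w} → OnPath q m w → V G w ≡ true ⊎ Inside q m w
    on-q-split (zero , _ , refl) = inj₁ q₀-old
    on-q-split (suc i , i≤m , refl) with suc i ℕ.≟ m
    ... | yes refl = inj₁ qₘ-old
    ... | no i≢m = inj₂ (suc i , (s≤s z≤n , ≤∧≢⇒< i≤m i≢m) , refl)

    on-s-split : ∀ {w} → OnPath s n w → Inside s n w ⊎ OnPath q m w
    on-s-split (zero , _ , refl) = inj₂ (0 , z≤n , sym s₀≡q₀)
    on-s-split (suc i , i≤n , refl) with suc i ℕ.≟ n
    ... | yes refl = inj₂ (m , ≤-refl , sym sₙ≡qₘ)
    ... | no i≢n = inj₁ (suc i , (s≤s z≤n , ≤∧≢⇒< i≤n i≢n) , refl)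

    Q′ : BarePath G′ q m
    Q′ = ear-bare Q

    S′ : BarePath G′ s n
    S′ = record
      { path     = record { injective = injective (path S) ; edge = old-edge Q ∘ edge (path S) }
      ; interior = nbrs
      }
      where
        nbrs : ∀ {i z} → suc i < n → E G′ (s (suc i)) z ≡ true → z ≡ s i ⊎ z ≡ s (suc (suc i))
        nbrs {i} i< e with to (edges _ _) e
        ... | inj₁ e′ = interior S i< e′
        ... | inj₂ (k , k<m , same) = ⊥-elim (inside-s-off-q (suc i , (s≤s z≤n , i<) , refl) (on-ear same))
          where
            on-ear : ∀ {z} → SameEdge (q k) (q (suc k)) (s (suc i)) z → OnPath q m (s (suc i))
            on-ear (inj₁ (e₁ , _)) = k , <⇒≤ k<m , sym e₁
            on-ear (inj₂ (e₁ , _)) = suc k , k<m , sym e₁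

    lift-to-G′ : ∀ {Y π} → PairingOn G Y π → PairingOn G′ Y π
    lift-to-G′ = pairingOn-transfer (λ _ → old-edge Q)

    old? : Decidable (Vertex G)
    old? w = V G w Bool.≟ true

    extended : (Fin N → Fin N) → Fin N → Fin N
    extended π = patch old? π (pathMate q m innerMate)

    extend : ∀ {π} → PerfectPairing G π → PerfectPairing G′ (extended π)
    extend {π} P = pairingOn-≐ (⊆ , ⊇)
      (pairingOn-patch old? π _ (λ { (i , (1≤i , i<m) , refl) vq → new≢old (fresh 1≤i i<m) vq refl })
                       (lift-to-G′ P) (inner-pairing {c = b} ear-path))
      where
        ⊆ : ∀ {w} → (Vertex G ∪ Inside q m) w → V G′ w ≡ true
        ⊆ (inj₁ vw) = old-vertex Q vw
        ⊆ (inj₂ ins) = from (vertices _) (inj₂ (inside⇒onPath ins))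
        ⊇ : ∀ {w} → V G′ w ≡ true → (Vertex G ∪ Inside q m) w
        ⊇ vw = [ inj₁ , on-q-split ]′ (to (vertices _) vw)

    extended-old : ∀ {π w} → V G w ≡ true → extended π w ≡ π w
    extended-old = patch-in old? _ _

    extended-inner : ∀ {π i} → 1 ≤ i → i < m → extended π (q i) ≡ q (innerMate i)
    extended-inner 1≤i i<m = trans (patch-out old? _ _ λ vq → new≢old (fresh 1≤i i<m) vq refl)
                                   (pathMate-at ear-path innerMate (<⇒≤ i<m))

    via-Q : (Fin N → Fin N) → Fin N → Fin N
    via-Q π = patch (onPath? q m) (pathMate q m outerMate) (patch (inside? s n) (pathMate s n innerMate) π)

    reroute-via-Q : ∀ {π} → PerfectPairing G π → π (s 0) ≡ s 1 → PerfectPairing G′ (via-Q π)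
    reroute-via-Q {π} P πs₀ = pairingOn-≐ (⊆ , ⊇)
      (pairingOn-patch (onPath? q m) _ _ off-q (outer-pairing {c = b} ear-path)
        (pairingOn-patch (inside? s n) _ π (λ (_ , off-s) ins → off-s (inside⇒onPath ins))
                         (inner-pairing {c = a} (path S′)) rest))
      where
        rest : PairingOn G′ (Vertex G ∖ OnPath s n) π
        rest = lift-to-G′ (pairingOn-∖ (λ { _ (i , i≤n , refl) →
                 outerMate i , outerMate-≤ a i≤n , sym (outer-forced {c = a} S P πs₀ i≤n) }) P)
        off-q : ∀ {w} → (Inside s n ∪ (Vertex G ∖ OnPath s n)) w → ¬ OnPath q m w
        off-q (inj₁ ins) = inside-s-off-q ins
        off-q (inj₂ (vw , off-s)) on-q = off-s (old-on-q-on-s on-q vw)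
        ⊆ : ∀ {w} → (OnPath q m ∪ (Inside s n ∪ (Vertex G ∖ OnPath s n))) w → V G′ w ≡ true
        ⊆ (inj₁ on-q) = from (vertices _) (inj₂ on-q)
        ⊆ (inj₂ (inj₁ (i , (_ , i<n) , refl))) = old-vertex Q (s-old (<⇒≤ i<n))
        ⊆ (inj₂ (inj₂ (vw , _))) = old-vertex Q vw
        ⊇ : ∀ {w} → V G′ w ≡ true → (OnPath q m ∪ (Inside s n ∪ (Vertex G ∖ OnPath s n))) w
        ⊇ {w} vw with onPath? q m w | inside? s n w
        ... | yes on-q | _ = inj₁ on-q
        ... | no _ | yes ins = inj₂ (inj₁ ins)
        ... | no off-q′ | no off-s with to (vertices w) vw
        ...   | inj₂ on-q = ⊥-elim (off-q′ on-q)
        ...   | inj₁ vG = inj₂ (inj₂ (vG , λ on-s → [ off-s , off-q′ ]′ (on-s-split on-s)))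

    via-Q-outer : ∀ {π i} → i ≤ m → via-Q π (q i) ≡ q (outerMate i)
    via-Q-outer i≤m = trans (patch-in (onPath? q m) _ _ (_ , i≤m , refl)) (pathMate-at ear-path outerMate i≤m)

    ear-edge-through : ∀ {k} → k < m → PairingThrough G′ (q k) (q (suc k))
    ear-edge-through {k} k<m with even-or-odd k | covG (edge (path S) (s≤s z≤n))
    ... | j , inj₁ refl | π , P , πs₀ =
      via-Q π , reroute-via-Q P πs₀ , trans (via-Q-outer (<⇒≤ k<m)) (cong q (outerMate-even j))
    ... | j , inj₂ refl | π , P , _ =
      extended π , extend P , trans (extended-inner (s≤s z≤n) k<m) (cong (q ∘ suc) (outerMate-even j))

    G′-edgeCovered : EdgeCovered G′
    G′-edgeCovered {x} {y} e with to (edges x y) e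
    ... | inj₁ e′ = let (π , P , πx≡y) = covG e′ in extended π , extend P , trans (extended-old (E-V G x y e′)) πx≡y
    ... | inj₂ (k , k<m , same) = let (π , P , πqₖ) = ear-edge-through k<m
                                  in pairingThrough-sameEdge P (path-vertexˡ ear-path k<m) πqₖ same

    G′-matchingCovered : MatchingCovered G′
    G′-matchingCovered = edgeCovered⇒matchingCovered (sum-connected Q (proj₁ (proj₁ mmG)) q₀-old)
                                                     (sum-nontrivial Q (proj₁ (proj₂ (proj₁ mmG)))) G′-edgeCovered

    module Deletion {x y : Fin N} (xy-old : E G x y ≡ true) (xy-off-S : ¬ PathEdge s n x y)
                    {H : Graph N} (H-def : DeleteEdge G′ x y H) (covH : EdgeCovered H) (connH : Connected H)
                    {K : Graph N} (K-def : DeleteEdge G x y K) where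

      G→K-vertex : ∀ {w} → V G w ≡ true → V K w ≡ true
      G→K-vertex = from (proj₁ K-def _)

      K→G-vertex : ∀ {w} → V K w ≡ true → V G w ≡ true
      K→G-vertex = to (proj₁ K-def _)

      G→H-vertex : ∀ {w} → V G w ≡ true → V H w ≡ true
      G→H-vertex = from (proj₁ H-def _) ∘ old-vertex Q

      H→G′-vertex : ∀ {w} → V H w ≡ true → V G′ w ≡ true
      H→G′-vertex = to (proj₁ H-def _)

      K→H : ∀ {u w} → E K u w ≡ true → E H u w ≡ true
      K→H e = let (e′ , ¬xy) = to (proj₂ K-def _ _) e in from (proj₂ H-def _ _) (old-edge Q e′ , ¬xy)

      H→K : ∀ {u w} → V G u ≡ true → V G w ≡ true → E H u w ≡ true → E K u w ≡ true
      H→K vu vw e = let (e′ , ¬xy) = to (proj₂ H-def _ _) e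
                    in from (proj₂ K-def _ _) (old-edge-back Q 2≤m vu vw e′ , ¬xy)

      S-edge-kept : ∀ {i} → i < n → ¬ SameEdge x y (s i) (s (suc i))
      S-edge-kept i<n same = xy-off-S (_ , i<n , sameEdge-sym same)

      S-H : BarePath H s n
      S-H = bare-delete S′ H-def S-edge-kept

      S-K : BarePath K s n
      S-K = bare-delete S K-def S-edge-kept

      Q-H : BarePath H q m
      Q-H = bare-delete Q′ H-def λ k<m same → [ old-new (E-V G x y xy-old) , old-new (E-Vʳ G x y xy-old) ]′
                                              (ear-edge-new-end Q 2≤m k<m (sameEdge-sym same))
        where
          old-new : ∀ {w} → V G w ≡ true → V G w ≡ false → ⊥
          old-new vw fw = true≢false (trans (sym vw) fw)

      restrict : ∀ {π} → PerfectPairing H π → π (q 0) ≢ q 1 → PerfectPairing K π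
      restrict {π} P πq₀≢q₁ = record
        { adjacent   = λ vw → H→K (K→G-vertex vw) (π-old vw) (adjacent P (G→H-vertex (K→G-vertex vw)))
        ; closed     = λ vw → G→K-vertex (π-old vw)
        ; involutive = λ vw → involutive P (G→H-vertex (K→G-vertex vw))
        }
        where
          π-old : ∀ {w} → V K w ≡ true → V G (π w) ≡ true
          π-old {w} vw = [ id , [ id , ⊥-elim ∘ not-inside ]′ ∘ on-q-split ]′
                           (to (vertices _) (H→G′-vertex (closed P (G→H-vertex (K→G-vertex vw)))))
            where
              not-inside : Inside q m (π w) → ⊥
              not-inside (j , (1≤j , j<m) , qⱼ≡πw) =
                let (1≤j′ , j′<m) = innerMate-inside b 1≤j j<m
                    q≡w = trans (sym (inner-forced Q-H 1≤b P πq₀≢q₁ 1≤j j<m))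
                                (mate-swap P (G→H-vertex (K→G-vertex vw)) (sym qⱼ≡πw))
                in new≢old (fresh 1≤j′ j′<m) (K→G-vertex vw) q≡w

      module _ {π : Fin N → Fin N} (P : PerfectPairing H π) (πq₀ : π (q 0) ≡ q 1) where

        private
          πs₀ : π (s 0) ≡ q 1
          πs₀ = trans (cong π s₀≡q₀) πq₀

          πsₙ : π (s n) ≡ q (b + b)
          πsₙ = trans (cong π sₙ≡qₘ) (trans (outer-forced {c = b} Q-H P πq₀ ≤-refl) (cong q (outerMate-odd b)))

        S-image-old : ∀ {j} → j ≤ n → V G (π (s j)) ≡ true → (1 ≤ j × j < n) × π (s j) ≡ s (innerMate j)
        S-image-old {zero} _ vπ = ⊥-elim (new≢old (fresh ≤-refl 2≤m) vπ (sym πs₀))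
        S-image-old {suc j} j≤n vπ with suc j ℕ.≟ n
        ... | yes refl = ⊥-elim (new≢old (fresh (≤-trans 1≤b (m≤m+n b b)) ≤-refl) vπ (sym πsₙ))
        ... | no j≢n = (s≤s z≤n , j<n) , inner-forced S-H 1≤a P πs₀≢s₁ (s≤s z≤n) j<n
          where
            j<n = ≤∧≢⇒< j≤n j≢n
            πs₀≢s₁ : π (s 0) ≢ s 1
            πs₀≢s₁ e = new≢old (fresh ≤-refl 2≤m) (s-old (s≤s z≤n)) (trans (sym πs₀) e)

        via-S : Fin N → Fin N
        via-S = patch (onPath? s n) (pathMate s n outerMate) π

        reroute-via-S : PerfectPairing K via-S
        reroute-via-S = pairingOn-≐ (⊆ , ⊇)
          (pairingOn-patch (onPath? s n) _ π proj₂ (outer-pairing {c = a} (path S-K)) rest)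
          where
            π-old : ∀ {w} → V G w ≡ true → ¬ OnPath s n w → V G (π w) ≡ true
            π-old {w} vw off-s = [ id , [ id , ⊥-elim ∘ not-inside ]′ ∘ on-q-split ]′
                                   (to (vertices _) (H→G′-vertex (closed P (G→H-vertex vw))))
              where
                not-inside : Inside q m (π w) → ⊥
                not-inside (j , (_ , j<m) , qⱼ≡πw) =
                  off-s (old-on-q-on-s (outerMate j , outerMate-≤ b (<⇒≤ j<m) , q≡w) vw)
                  where
                    q≡w = trans (sym (outer-forced {c = b} Q-H P πq₀ (<⇒≤ j<m)))
                                (mate-swap P (G→H-vertex vw) (sym qⱼ≡πw))
            π-off-s : ∀ {w} → V G w ≡ true → ¬ OnPath s n w → ¬ OnPath s n (π w)
            π-off-s {w} vw off-s (j , j≤n , sⱼ≡πw) =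
              let sⱼ↦w = mate-swap P (G→H-vertex vw) (sym sⱼ≡πw)
                  ((1≤j , j<n) , πsⱼ) = S-image-old j≤n (subst (λ t → V G t ≡ true) (sym sⱼ↦w) vw)
              in off-s (innerMate j , <⇒≤ (proj₂ (innerMate-inside a 1≤j j<n)) , trans (sym πsⱼ) sⱼ↦w)
            rest : PairingOn K (Vertex G ∖ OnPath s n) π
            rest = record
              { adjacent   = λ (vw , off-s) → H→K vw (π-old vw off-s) (adjacent P (G→H-vertex vw))
              ; closed     = λ (vw , off-s) → π-old vw off-s , π-off-s vw off-s
              ; involutive = λ (vw , _) → involutive P (G→H-vertex vw)
              }
            ⊆ : ∀ {w} → (OnPath s n ∪ (Vertex G ∖ OnPath s n)) w → V K w ≡ true
            ⊆ (inj₁ (i , i≤n , refl)) = G→K-vertex (s-old i≤n)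
            ⊆ (inj₂ (vw , _)) = G→K-vertex vw
            ⊇ : ∀ {w} → V K w ≡ true → (OnPath s n ∪ (Vertex G ∖ OnPath s n)) w
            ⊇ {w} vw with onPath? s n w
            ... | yes on-s = inj₁ on-s
            ... | no off-s = inj₂ (K→G-vertex vw , off-s)

      K-edge-off-S : ∀ {z t} → E K z t ≡ true → ¬ PathEdge s n z t → PairingThrough K z t
      K-edge-off-S {z} {t} e off with covH (K→H e)
      ... | π , P , πz≡t with π (q 0) ≟ q 1
      ...   | no πq₀≢q₁ = π , restrict P πq₀≢q₁ , πz≡t
      ...   | yes πq₀ = via-S P πq₀ , reroute-via-S P πq₀ , trans (patch-out (onPath? s n) _ _ z-off-s) πz≡t
        where
          z-off-s : ¬ OnPath s n z
          z-off-s (j , j≤n , refl) =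
            let vt = subst (λ w → V G w ≡ true) (sym πz≡t) (K→G-vertex (E-Vʳ K _ _ e))
                ((1≤j , j<n) , πsⱼ) = S-image-old P πq₀ j≤n vt
            in off (subst (PathEdge s n (s j)) (trans (sym πsⱼ) πz≡t)
                     (neighbours-pathEdge (<⇒≤ j<n) (<⇒≤ (proj₂ (innerMate-inside a 1≤j j<n)))
                                          (innerMate-neighbours 1≤j)))

      K-s₀s₁ : PairingThrough K (s 0) (s 1)
      K-s₀s₁ with covH (edge (path S-H) (s≤s z≤n))
      ... | π , P , πs₀ = π , restrict P πq₀≢q₁ , πs₀
        where
          πq₀≢q₁ : π (q 0) ≢ q 1
          πq₀≢q₁ πq₀ = new≢old (fresh ≤-refl 2≤m) (s-old (s≤s z≤n))
                                (trans (sym πq₀) (trans (cong π (sym s₀≡q₀)) πs₀))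

      n≢0 : n ≢ 0
      n≢0 ()

      Incident : Fin N → Set
      Incident v = v ≡ x ⊎ v ≡ y

      not-both-ends-incident : Incident (s 0) → Incident (s n) → ⊥
      not-both-ends-incident (inj₁ refl) (inj₁ e) = n≢0 (injective (path S) ≤-refl z≤n e)
      not-both-ends-incident (inj₂ refl) (inj₂ e) = n≢0 (injective (path S) ≤-refl z≤n e)
      not-both-ends-incident (inj₁ refl) (inj₂ refl) = true≢false (trans (sym xy-old) s₀≁sₙ)
      not-both-ends-incident (inj₂ refl) (inj₁ refl) = true≢false (trans (sym (edge-sym G xy-old)) s₀≁sₙ)

      unincident-edge : ∀ {v t} → ¬ Incident v → E G v t ≡ true → E K v t ≡ true
      unincident-edge ¬inc e = from (proj₂ K-def _ _)
        (e , λ { (inj₁ (v≡x , _)) → ¬inc (inj₁ v≡x) ; (inj₂ (v≡y , _)) → ¬inc (inj₂ v≡y) })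

      -- One end of S is not incident with xy; a pairing through one of its edges off S cannot match S outer.
      K-pairing-off-s₀s₁ : Σ (Fin N → Fin N) λ π → PerfectPairing K π × π (s 0) ≢ s 1
      K-pairing-off-s₀s₁ with (s 0 ≟ x) ⊎-dec (s 0 ≟ y)
      ... | no ¬inc₀ with end-neighbour-besides covG (path S) (≤-trans (n≤1+n 2) 3≤n)
      ...   | t , e , t≢s₁ with K-edge-off-S (unincident-edge ¬inc₀ e) off
        where
          off : ¬ PathEdge s n (s 0) t
          off (k , k<n , inj₁ (s₀≡ , t≡)) with injective (path S) z≤n (<⇒≤ k<n) s₀≡
          ... | refl = t≢s₁ t≡
          off (k , k<n , inj₂ (s₀≡ , _)) with injective (path S) z≤n k<n s₀≡
          ... | ()
      ...     | π , P , πs₀ = π , P , λ πs₀≡s₁ → t≢s₁ (trans (sym πs₀) πs₀≡s₁)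
      K-pairing-off-s₀s₁ | yes inc₀ with end-neighbour-besides covG (path (reverse-bare S)) (≤-trans (n≤1+n 2) 3≤n)
      ...   | t , e , t≢sₙ₋₁ with K-edge-off-S (unincident-edge (not-both-ends-incident inc₀) e) off
        where
          off : ¬ PathEdge s n (s n) t
          off (k , k<n , inj₁ (sₙ≡ , _)) with injective (path S) ≤-refl (<⇒≤ k<n) sₙ≡
          ... | refl = <-irrefl refl k<n
          off (k , k<n , inj₂ (sₙ≡ , t≡)) with injective (path S) ≤-refl k<n sₙ≡
          ... | refl = t≢sₙ₋₁ t≡
      ...     | π , P , πsₙ = π , P , λ πs₀≡s₁ → t≢sₙ₋₁ (trans (sym πsₙ)
                  (trans (outer-forced {c = a} S-K P πs₀≡s₁ ≤-refl) (cong s (outerMate-odd a))))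

      K-S-edge : ∀ {k} → k < n → PairingThrough K (s k) (s (suc k))
      K-S-edge {k} k<n with even-or-odd k
      ... | j , inj₁ refl = let (π , P , πs₀) = K-s₀s₁
                            in π , P , trans (outer-forced {c = a} S-K P πs₀ (<⇒≤ k<n)) (cong s (outerMate-even j))
      ... | j , inj₂ refl = let (π , P , πs₀≢s₁) = K-pairing-off-s₀s₁
                            in π , P , trans (inner-forced S-K 1≤a P πs₀≢s₁ (s≤s z≤n) k<n)
                                             (cong (s ∘ suc) (outerMate-even j))

      K-edgeCovered : EdgeCovered K
      K-edgeCovered {z} {t} e with pathEdge? s n z t
      ... | no off = K-edge-off-S e off
      ... | yes (k , k<n , same) = let (π , P , πsₖ) = K-S-edge k<n
                                   in pairingThrough-sameEdge P (path-vertexˡ (path S-K) k<n) πsₖ same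

      -- Contracting the new vertices of Q onto s₀ turns walks of G′ − xy into walks of G − xy.
      collapse : Fin N → Fin N
      collapse = patch old? id (λ _ → s 0)

      collapse-old : ∀ {w} → V G w ≡ true → collapse w ≡ w
      collapse-old = patch-in old? id (λ _ → s 0)

      collapse-ear : ∀ {j} → j ≤ m → collapse (q j) ≡ s 0 ⊎ collapse (q j) ≡ s n
      collapse-ear {j} j≤m = by-age (old? (q j))
        where
          by-age : Dec (V G (q j) ≡ true) → collapse (q j) ≡ s 0 ⊎ collapse (q j) ≡ s n
          by-age (no new) = inj₁ (patch-out old? _ _ new)
          by-age (yes vq) with old-on-ear Q j≤m vq
          ... | inj₁ refl = inj₁ (trans (collapse-old vq) (sym s₀≡q₀))
          ... | inj₂ refl = inj₂ (trans (collapse-old vq) (sym sₙ≡qₘ))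

      S-ends-connected : ∀ {u w} → u ≡ s 0 ⊎ u ≡ s n → w ≡ s 0 ⊎ w ≡ s n → Reach K u w
      S-ends-connected (inj₁ refl) (inj₁ refl) = here
      S-ends-connected (inj₁ refl) (inj₂ refl) = path-reach (path S-K) ≤-refl
      S-ends-connected (inj₂ refl) (inj₁ refl) = reach-sym (path-reach (path S-K) ≤-refl)
      S-ends-connected (inj₂ refl) (inj₂ refl) = here

      collapse-edge : ∀ {u w} → E H u w ≡ true → Reach K (collapse u) (collapse w)
      collapse-edge {u} {w} e with to (edges u w) (proj₁ (to (proj₂ H-def u w) e))
      ... | inj₁ e′ rewrite collapse-old (E-V G u w e′) | collapse-old (E-Vʳ G u w e′) =
        step (H→K (E-V G u w e′) (E-Vʳ G u w e′) e) here
      ... | inj₂ (k , k<m , inj₁ (refl , refl)) = S-ends-connected (collapse-ear (<⇒≤ k<m)) (collapse-ear k<m)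
      ... | inj₂ (k , k<m , inj₂ (refl , refl)) = S-ends-connected (collapse-ear k<m) (collapse-ear (<⇒≤ k<m))

      K-connected : Connected K
      K-connected u w vu vw = subst₂ (Reach K) (collapse-old (K→G-vertex vu)) (collapse-old (K→G-vertex vw))
        (reach-map collapse collapse-edge (connH u w (G→H-vertex (K→G-vertex vu)) (G→H-vertex (K→G-vertex vw))))

      K-matchingCovered : MatchingCovered K
      K-matchingCovered = edgeCovered⇒matchingCovered K-connected K-nontrivial K-edgeCovered
        where
          K-nontrivial : Nontrivial K
          K-nontrivial = let (u , w , u≢w , vu , vw) = proj₁ (proj₂ (proj₁ mmG))
                         in u , w , u≢w , G→K-vertex vu , G→K-vertex vw

    G′-minimal : ∀ x y → E G′ x y ≡ true → ∀ H → DeleteEdge G′ x y H → ¬ MatchingCovered H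
    G′-minimal x y e H H-def mcH with to (edges x y) e
    ... | inj₂ (k , k<m , same) = gapped-bare-path Q′ 3≤m q₀s₁ s₁≢q₁ k<m same H-def covH
      where
        q₀s₁ : E G′ (q 0) (s 1) ≡ true
        q₀s₁ = subst (λ w → E G′ w (s 1) ≡ true) s₀≡q₀ (edge (path S′) (s≤s z≤n))
        s₁≢q₁ : s 1 ≢ q 1
        s₁≢q₁ e = new≢old (fresh ≤-refl 2≤m) (s-old (s≤s z≤n)) (sym e)
        covH = matchingCovered⇒edgeCovered mcH
    ... | inj₁ e′ with pathEdge? s n x y
    ...   | yes (k , k<n , same) = gapped-bare-path S′ 3≤n s₀q₁ q₁≢s₁ k<n same H-def covH
      where
        s₀q₁ : E G′ (s 0) (q 1) ≡ true
        s₀q₁ = subst (λ w → E G′ w (q 1) ≡ true) (sym s₀≡q₀) (edge ear-path (s≤s z≤n))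
        q₁≢s₁ : q 1 ≢ s 1
        q₁≢s₁ = new≢old (fresh ≤-refl 2≤m) (s-old (s≤s z≤n))
        covH = matchingCovered⇒edgeCovered mcH
    ...   | no off-S = proj₂ mmG x y e′ K K-def
                         (Deletion.K-matchingCovered e′ off-S H-def (matchingCovered⇒edgeCovered mcH) (proj₁ mcH) K-def)
      where
        K = proj₁ (deleteEdge G x y)
        K-def = proj₂ (deleteEdge G x y)

    G′-minimalMatchingCovered : MinimalMatchingCovered G′
    G′-minimalMatchingCovered = G′-matchingCovered , G′-minimal

lookupOr : {A : Set} → A → List A → ℕ → A
lookupOr d []       _       = d
lookupOr d (x ∷ xs) zero    = x
lookupOr d (x ∷ xs) (suc i) = lookupOr d xs i

module _ {N : ℕ} where

  At-lookupOr : ∀ (d : Fin N) xs {i} → i < length xs → At {N} xs i (lookupOr d xs i)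
  At-lookupOr d (x ∷ xs) {zero}  _       = here
  At-lookupOr d (x ∷ xs) {suc i} (s≤s i<) = there (At-lookupOr d xs i<)

  lookupOr-At : ∀ (d : Fin N) {xs i x} → At {N} xs i x → lookupOr d xs i ≡ x
  lookupOr-At d here      = refl
  lookupOr-At d (there a) = lookupOr-At d a

  At-< : ∀ {xs : List (Fin N)} {i x} → At {N} xs i x → i < length xs
  At-< here      = s≤s z≤n
  At-< (there a) = s≤s (At-< a)

  At⇒∈ : ∀ {xs : List (Fin N)} {i x} → At {N} xs i x → x ∈ xs
  At⇒∈ here      = here refl
  At⇒∈ (there a) = there (At⇒∈ a)

  ∈⇒At : ∀ {xs : List (Fin N)} {x} → x ∈ xs → Σ ℕ λ i → At {N} xs i x
  ∈⇒At (here refl) = 0 , here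
  ∈⇒At (there x∈) = let (i , a) = ∈⇒At x∈ in suc i , there a

  At-unique : ∀ {xs : List (Fin N)} {i j x} → Unique xs → At {N} xs i x → At {N} xs j x → i ≡ j
  At-unique _          here      here      = refl
  At-unique (x∉ ∷ _)   here      (there b) = ⊥-elim (All.lookup x∉ (At⇒∈ b) refl)
  At-unique (x∉ ∷ _)   (there a) here      = ⊥-elim (All.lookup x∉ (At⇒∈ a) refl)
  At-unique (_ ∷ uniq) (there a) (there b) = cong suc (At-unique uniq a b)

  Consec⇒At : ∀ {xs : List (Fin N)} {x y} → Consec {N} xs x y → Σ ℕ λ i → At {N} xs i x × At {N} xs (suc i) y
  Consec⇒At here      = 0 , here , there here
  Consec⇒At (there c) = let (i , a , b) = Consec⇒At c in suc i , there a , there b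

  At⇒Consec : ∀ {xs : List (Fin N)} {i x y} → At {N} xs i x → At {N} xs (suc i) y → Consec {N} xs x y
  At⇒Consec here      (there here) = here
  At⇒Consec (there a) (there b)    = there (At⇒Consec a b)

  At-∷ʳ-end : ∀ (xs : List (Fin N)) y → At {N} (xs ∷ʳ y) (length xs) y
  At-∷ʳ-end []       y = here
  At-∷ʳ-end (x ∷ xs) y = there (At-∷ʳ-end xs y)

  At-∷ʳ-inv : ∀ (xs : List (Fin N)) y {i x} → At {N} (xs ∷ʳ y) i x → At {N} xs i x ⊎ i ≡ length xs
  At-∷ʳ-inv []       y here      = inj₂ refl
  At-∷ʳ-inv (z ∷ xs) y here      = inj₁ here
  At-∷ʳ-inv (z ∷ xs) y (there a) = Sum.map there (cong suc) (At-∷ʳ-inv xs y a)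

  vertexAt : Ear N → ℕ → Fin N
  vertexAt R = lookupOr (start R) (verts R)

  earLength : Ear N → ℕ
  earLength R = suc (length (inner R))

  module _ (R : Ear N) where

    length-verts : length (verts R) ≡ suc (earLength R)
    length-verts = cong suc (trans (length-++ (inner R)) (+-comm (length (inner R)) 1))

    vertexAt-At : ∀ {i} → i ≤ earLength R → At {N} (verts R) i (vertexAt R i)
    vertexAt-At {i} i≤ = At-lookupOr (start R) (verts R) (subst (i <_) (sym length-verts) (s≤s i≤))

    At-vertexAt : ∀ {i x} → At {N} (verts R) i x → vertexAt R i ≡ x
    At-vertexAt = lookupOr-At (start R)

    At-verts-≤ : ∀ {i x} → At {N} (verts R) i x → i ≤ earLength R
    At-verts-≤ {i} a = ≤-pred (subst (suc i ≤_) length-verts (At-< a))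

    vertexAt-end : vertexAt R (earLength R) ≡ end R
    vertexAt-end = At-vertexAt (there (At-∷ʳ-end (inner R) (end R)))

    verts⇔onPath : ∀ {x} → x ∈ verts R ⇔ OnPath (vertexAt R) (earLength R) x
    verts⇔onPath = mk⇔ (λ x∈ → let (i , a) = ∈⇒At x∈ in i , At-verts-≤ a , At-vertexAt a)
                       (λ { (i , i≤ , refl) → At⇒∈ (vertexAt-At i≤) })

    earEdge⇔pathEdge : ∀ {x y} → EarEdge R x y ⇔ PathEdge (vertexAt R) (earLength R) x y
    earEdge⇔pathEdge = mk⇔ along back
      where
        along : ∀ {x y} → EarEdge R x y → PathEdge (vertexAt R) (earLength R) x y
        along (inj₁ c) = let (i , a , b) = Consec⇒At c in i , At-verts-≤ b , inj₁ (sym (At-vertexAt a) , sym (At-vertexAt b))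
        along (inj₂ c) = let (i , a , b) = Consec⇒At c in i , At-verts-≤ b , inj₂ (sym (At-vertexAt b) , sym (At-vertexAt a))
        back : ∀ {x y} → PathEdge (vertexAt R) (earLength R) x y → EarEdge R x y
        back (i , i< , inj₁ (refl , refl)) = inj₁ (At⇒Consec (vertexAt-At (<⇒≤ i<)) (vertexAt-At i<))
        back (i , i< , inj₂ (refl , refl)) = inj₂ (At⇒Consec (vertexAt-At (<⇒≤ i<)) (vertexAt-At i<))

    inside⇒inner : ∀ {x} → Inside (vertexAt R) (earLength R) x → x ∈ inner R
    inside⇒inner (suc i , (_ , s≤s i<) , refl) with vertexAt-At (<⇒≤ (s≤s i<))
    ... | there a with At-∷ʳ-inv (inner R) (end R) a
    ...   | inj₁ b = At⇒∈ b
    ...   | inj₂ refl = ⊥-elim (<-irrefl refl i<)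

    ear-path : ∀ {K} → Unique (verts R) → (∀ {x y} → EarEdge R x y → E K x y ≡ true)
             → Path K (vertexAt R) (earLength R)
    ear-path uniq earEdge = record
      { injective = λ i≤ j≤ e → At-unique uniq (vertexAt-At i≤) (subst (At {N} (verts R) _) (sym e) (vertexAt-At j≤))
      ; edge      = λ i< → earEdge (from earEdge⇔pathEdge (_ , i< , inj₁ (refl , refl)))
      }

    earSum⇒pathSum : ∀ {G G′} → IsEar G R → IsEarSum G R G′ → PathSum G (vertexAt R) (earLength R) G′
    earSum⇒pathSum R-ear (vertices , edges) = record
      { ear-path = ear-path (proj₁ (proj₂ (proj₂ (proj₂ R-ear)))) λ {x} {y} ee → from (edges x y) (inj₂ ee)
      ; fresh    = λ 1≤i i< → All.lookup (proj₁ (proj₂ (proj₂ R-ear))) (inside⇒inner (_ , (1≤i , i<) , refl))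
      ; vertices = λ w → mk⇔ (Sum.map₂ (to verts⇔onPath) ∘′ to (vertices w))
                             (from (vertices w) ∘′ Sum.map₂ (from verts⇔onPath))
      ; edges    = λ x y → mk⇔ (Sum.map₂ (to earEdge⇔pathEdge) ∘′ to (edges x y))
                               (from (edges x y) ∘′ Sum.map₂ (from earEdge⇔pathEdge))
      }

module _ {N : ℕ} where

  record Subgraph (H K : Graph N) : Set where
    field
      V⊆ : ∀ {w} → V H w ≡ true → V K w ≡ true
      E⊆ : ∀ {x y} → E H x y ≡ true → E K x y ≡ true
  open Subgraph public

  ⊆-refl : ∀ {H} → Subgraph H H
  ⊆-refl = record { V⊆ = id ; E⊆ = id }

  ⊆-trans : ∀ {H K L} → Subgraph H K → Subgraph K L → Subgraph H L
  ⊆-trans H⊆K K⊆L = record { V⊆ = V⊆ K⊆L ∘ V⊆ H⊆K ; E⊆ = E⊆ K⊆L ∘ E⊆ H⊆K }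

  earSum-⊆ : ∀ {H R H′} → IsEarSum H R H′ → Subgraph H H′
  earSum-⊆ (vertices , edges) = record { V⊆ = λ v → from (vertices _) (inj₁ v) ; E⊆ = λ e → from (edges _ _) (inj₁ e) }

  EndOf : Fin N → Ear N → Set
  EndOf x R = x ≡ start R ⊎ x ≡ end R

  verts-split : ∀ {R : Ear N} {x} → x ∈ verts R → EndOf x R ⊎ x ∈ inner R
  verts-split (here refl) = inj₁ (inj₁ refl)
  verts-split {R} (there x∈) with ∈-++⁻ (inner R) x∈
  ... | inj₁ x∈inner = inj₂ x∈inner
  ... | inj₂ (here refl) = inj₁ (inj₂ refl)

  earEdge-∈ : ∀ {R : Ear N} {x y} → EarEdge R x y → x ∈ verts R
  earEdge-∈ (inj₁ c) = At⇒∈ (proj₁ (proj₂ (Consec⇒At c)))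
  earEdge-∈ (inj₂ c) = At⇒∈ (proj₂ (proj₂ (Consec⇒At c)))

  compatible-gap : ∀ {L : List (Fin N)} {Q R lo hi k} → Compatible L Q R
                 → EndPos L Q lo → EndPos L Q hi → lo < k → k < hi → ¬ EndPos L R k
  compatible-gap (inj₁ Q-first) _ Q-hi _ k<hi R-k = <-asym k<hi (Q-first _ _ Q-hi R-k)
  compatible-gap (inj₂ R-first) Q-lo _ lo<k _ R-k = <-asym lo<k (R-first _ _ Q-lo R-k)

  module _ {G : Graph N} (D : BipEarDecomp G) where

    stage-step : ∀ {i} → i < len D → IsEarSum (stage D i) (ear D (suc i)) (stage D (suc i))
    stage-step i< = proj₂ (steps D _ i<)

    ear-isEar : ∀ {i} → i < len D → IsEar (stage D i) (ear D (suc i))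
    ear-isEar i< = proj₁ (proj₁ (steps D _ i<))

    stage-⊆ : ∀ {i j} → i ≤ j → j ≤ len D → Subgraph (stage D i) (stage D j)
    stage-⊆ {j = zero}  z≤n _   = ⊆-refl
    stage-⊆ {j = suc j} i≤ j<  with m≤n⇒m<n∨m≡n i≤
    ... | inj₂ refl = ⊆-refl
    ... | inj₁ i<   = ⊆-trans (stage-⊆ (≤-pred i<) (<⇒≤ j<)) (earSum-⊆ (stage-step j<))

    stage-⊆-final : ∀ {i} → i ≤ len D → Subgraph (stage D i) G
    stage-⊆-final i≤ = ⊆-trans (stage-⊆ i≤ ≤-refl)
                               (record { V⊆ = to (proj₁ (final D) _) ; E⊆ = to (proj₂ (final D) _ _) })

    ear-edge-final : ∀ {i x y} → i < len D → EarEdge (ear D (suc i)) x y → E G x y ≡ true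
    ear-edge-final i< ee = E⊆ (stage-⊆-final i<) (from (proj₂ (stage-step i<) _ _) (inj₂ ee))

    inner-vertex-edges : ∀ {j x z} → j < len D → x ∈ inner (ear D (suc j))
      → (∀ {i} → j < i → i < len D → ¬ EndOf x (ear D (suc i)))
      → E G x z ≡ true → EarEdge (ear D (suc j)) x z
    inner-vertex-edges {j} {x} {z} j<len x∈ not-end e = go (len D) ≤-refl j<len (from (proj₂ (final D) x z) e)
      where
        new-at-j : V (stage D j) x ≡ false
        new-at-j = All.lookup (proj₁ (proj₂ (proj₂ (ear-isEar j<len)))) x∈
        old-after : ∀ {i} → j < i → i ≤ len D → V (stage D i) x ≡ true
        old-after j<i i≤ = V⊆ (stage-⊆ j<i i≤) (from (proj₁ (stage-step j<len) x) (inj₂ (there (∈-++⁺ˡ x∈))))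
        go : ∀ i → i ≤ len D → j < i → E (stage D i) x z ≡ true → EarEdge (ear D (suc j)) x z
        go (suc i) i<len j<1+i e′ with to (proj₂ (stage-step i<len) x z) e′ | m≤n⇒m<n∨m≡n (≤-pred j<1+i)
        ... | inj₂ ee  | inj₂ refl = ee
        ... | inj₁ e″ | inj₂ refl = ⊥-elim (true≢false (trans (sym (E-V (stage D j) x z e″)) new-at-j))
        ... | inj₁ e″ | inj₁ j<i  = go i (<⇒≤ i<len) j<i e″
        ... | inj₂ ee  | inj₁ j<i with verts-split (earEdge-∈ ee)
        ...   | inj₁ x-end   = ⊥-elim (not-end j<i i<len x-end)
        ...   | inj₂ x∈inner = ⊥-elim (true≢false (trans (sym (old-after j<i (<⇒≤ i<len)))
                                   (All.lookup (proj₁ (proj₂ (proj₂ (ear-isEar i<len)))) x∈inner)))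

  module _ {G : Graph N} (D : BipEarDecomp G) {k r : ℕ} (len≡ : len D ≡ suc (k + r)) (Q : Ear N)
           (compatible : ∀ i → 1 ≤ i → i ≤ r → Compatible (verts (ear D (suc k))) Q (ear D (suc (k + i)))) where

    private
      P = ear D (suc k)
      p = vertexAt P
      ℓ = earLength P

      k<len : k < len D
      k<len = subst (k <_) (sym len≡) (s≤s (m≤m+n k r))

    later-compatible : ∀ {i} → k < i → i < len D → Compatible (verts P) Q (ear D (suc i))
    later-compatible {i} k<i i<len = subst (λ t → Compatible (verts P) Q (ear D (suc t))) (m+[n∸m]≡n (<⇒≤ k<i))
      (compatible (i ∸ k) (m<n⇒0<n∸m k<i) (m≤n+o⇒m∸n≤o i k (≤-pred (subst (i <_) len≡ i<len))))

    P-path : Path G p ℓ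
    P-path = ear-path P (proj₁ (proj₂ (proj₂ (proj₂ (ear-isEar D k<len))))) (ear-edge-final D k<len)

    segment-interior : ∀ {lo hi} → EndPos (verts P) Q lo → EndPos (verts P) Q hi → hi ≤ ℓ
      → ∀ {m z} → lo < m → m < hi → E G (p m) z ≡ true → Σ ℕ λ j → Neighbours m j × z ≡ p j
    segment-interior Q-lo Q-hi hi≤ℓ {m} lo<m m<hi e =
      pathEdge-neighbour P-path (<⇒≤ m<ℓ) (to (earEdge⇔pathEdge P) (inner-vertex-edges D k<len pₘ∈inner not-end e))
      where
        m<ℓ = ≤-trans m<hi hi≤ℓ
        pₘ∈inner = inside⇒inner P (m , (≤-trans (s≤s z≤n) lo<m , m<ℓ) , refl)
        not-end : ∀ {i} → k < i → i < len D → ¬ EndOf (p m) (ear D (suc i))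
        not-end {i} k<i i<len pₘ-end = compatible-gap {L = verts P} {Q} {ear D (suc i)} (later-compatible k<i i<len)
                                                      Q-lo Q-hi lo<m m<hi (end-pos {ear D (suc i)} pₘ-end)
          where
            at-m : ∀ {x} → p m ≡ x → At {N} (verts P) m x
            at-m e = subst (At {N} (verts P) m) e (vertexAt-At P (<⇒≤ m<ℓ))
            end-pos : ∀ {R} → EndOf (p m) R → EndPos (verts P) R m
            end-pos (inj₁ e) = inj₁ (at-m e)
            end-pos (inj₂ e) = inj₂ (at-m e)

    segment-bare : start Q ∈ verts P → end Q ∈ verts P
            → Σ (ℕ → Fin N) λ s → Σ ℕ λ n → BarePath G s n × s 0 ≡ start Q × s n ≡ end Q
    segment-bare u∈P v∈P with ∈⇒At u∈P | ∈⇒At v∈P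
    ... | i₀ , u-at | j₀ , v-at with ≤-total i₀ j₀
    ...   | inj₁ i₀≤j₀ =
            (λ i → p (i₀ + i)) , j₀ ∸ i₀
          , subpath-bare P-path i₀≤j₀ (At-verts-≤ P v-at) (segment-interior (inj₁ u-at) (inj₂ v-at) (At-verts-≤ P v-at))
          , trans (cong p (+-identityʳ i₀)) (At-vertexAt P u-at)
          , trans (cong p (m+[n∸m]≡n i₀≤j₀)) (At-vertexAt P v-at)
    ...   | inj₂ j₀≤i₀ =
            (λ i → p (j₀ + (i₀ ∸ j₀ ∸ i))) , i₀ ∸ j₀
          , reverse-bare (subpath-bare P-path j₀≤i₀ (At-verts-≤ P u-at)
                                       (segment-interior (inj₂ v-at) (inj₁ u-at) (At-verts-≤ P u-at)))
          , trans (cong p (m+[n∸m]≡n j₀≤i₀)) (At-vertexAt P u-at)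
          , trans (cong (λ t → p (j₀ + t)) (n∸n≡0 (i₀ ∸ j₀))) (trans (cong p (+-identityʳ j₀)) (At-vertexAt P v-at))

  nontrivial-half : ∀ {Q : Ear N} {t} → NontrivialEar Q → length (inner Q) ≡ t + t → 1 ≤ t
  nontrivial-half {t = suc t} _ _ = s≤s z≤n
  nontrivial-half {Q} {zero} nontrivial len≡0 with inner Q
  ... | [] = ⊥-elim (nontrivial refl)

lemma2p10 : ∀ {N : ℕ} (G : Graph N) (D : BipEarDecomp G) (k r : ℕ)
    → MinimalMatchingCovered G → Bipartite G
    → 1 ≤ k → len D ≡ suc (k + r)
    → (∀ i → 1 ≤ i → i ≤ r →
         start (ear D (suc (k + i))) ∈ verts (ear D (suc k))
         ⊎ end (ear D (suc (k + i))) ∈ verts (ear D (suc k)))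
    → (Q : Ear N) → IsEar G Q → NontrivialEar Q
    → start Q ∈ verts (ear D (suc k)) → end Q ∈ verts (ear D (suc k))
    → E G (start Q) (end Q) ≡ false
    → DifferentParts G (start Q) (end Q)
    → (∀ i → 1 ≤ i → i ≤ r →
         Compatible (verts (ear D (suc k))) Q (ear D (suc (k + i))))
    → (G′ : Graph N) → IsEarSum G Q G′
    → MinimalMatchingCovered G′ × Bipartite G′
lemma2p10 G D k r G-minimal G-bipartite@(c , c-proper) _ len≡ _ Q Q-ear@(_ , _ , _ , _ , (t , inner≡) , _) Q-nontrivial
          u∈P v∈P u≁v u|v compatible G′ G′≡G+Q
  with segment-bare D len≡ Q compatible u∈P v∈P
... | s , n , S , s₀≡u , sₙ≡v
      with odd-path c-proper (path S) (subst₂ (λ x y → c x ≢ c y) (sym s₀≡u) (sym sₙ≡v) (u|v c c-proper))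
... | a , refl =
    ParallelEar.G′-minimalMatchingCovered G-minimal {a = a} S s₀≁sₙ {b = t} Q-sum
      (nontrivial-half {Q = Q} Q-nontrivial inner≡) s₀≡u sₙ≡qₘ
  , sum-bipartite {b = t} Q-sum G-bipartite (subst (DifferentParts G (start Q)) (sym qₘ≡v) u|v)
  where
    Q-sum : PathSum G (vertexAt Q) (suc (t + t)) G′
    Q-sum = subst (λ m → PathSum G (vertexAt Q) m G′) (cong suc inner≡) (earSum⇒pathSum Q Q-ear G′≡G+Q)
    qₘ≡v : vertexAt Q (suc (t + t)) ≡ end Q
    qₘ≡v = subst (λ m → vertexAt Q (suc m) ≡ end Q) inner≡ (vertexAt-end Q)
    s₀≁sₙ : E G (s 0) (s (suc (a + a))) ≡ false
    s₀≁sₙ = subst₂ (λ x y → E G x y ≡ false) (sym s₀≡u) (sym sₙ≡v) u≁v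
    sₙ≡qₘ : s (suc (a + a)) ≡ vertexAt Q (suc (t + t))
    sₙ≡qₘ = trans sₙ≡v (sym qₘ≡v)
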